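{- Let $n\ge 1$ and let $P(n)$ denote the number of convex pentagons in an $n$-triangular net. Then \[ P(n)=\begin{cases} \frac{1}{10}\left(12k^5+25k^4+5k^3-10k^2-2k\right), & n=2k+1\ (k=0,1,2,\dots),\\[2pt] \frac{1}{10}\left(12k^5-5k^4-15k^3+5k^2+3k\right), & n=2k\ (k=1,2,\dots).\end{cases} \]
   Context: An $n$-triangular net ($n\ge 1$) is obtained from a triangle by dividing each of its three edges into $n$ equal parts and then, for each pair of edges, drawing the $n-1$ segments joining corresponding dividing points on those two edges parallel to the third edge. (For $n=1$ it is just the triangle.) The net thus consists of the three edges of the triangle together with these segments; all line segments of the net lie on lines parallel to one of the three sides. A convex pentagon in the net is a convex polygon with exactly five vertices (each interior angle strictly less than $\pi$) whose sides all lie on segments of the net (so its vertices are intersection points of the net). The count depends only on $n$, not on the shape or size of the triangle. -}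

module Defs where

open import Data.Nat as ℕ using (ℕ; zero; suc)
open import Data.Integer as ℤ using (ℤ; +_; _-_; _*_; _+_; _<_; _≤_)
open import Data.Integer.Properties as ℤP using ()
open import Data.Product using (_×_; _,_; proj₁; proj₂)
open import Data.Sum using (_⊎_)
open import Data.Fin using (Fin) renaming (zero to f0; suc to fs)
open import Data.Fin.Properties using (all?)
open import Data.List using (List; []; _∷_; map; concatMap; upTo; length; filter)
open import Data.Vec.Functional using (Vector)
open import Relation.Binary.PropositionalEquality using (_≡_; _≢_)
open import Relation.Nullary using (¬_; Dec)
open import Relation.Nullary.Decidable using (_×-dec_; _⊎-dec_; ¬?)

-- Use affine (lattice) coordinates on the triangle with vertices
-- A = (0,0), B = (n,0), C = (0,n): the point a·(B-A)/n + b·(C-A)/n is (a , b).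
-- The net lines are  a = c,  b = c,  a + b = c  (c = 0..n), i.e. the lines
-- parallel to AC, AB, BC through the division points.  Their intersection
-- points (the net vertices) are exactly the lattice points (a , b) with
-- a , b ≥ 0 and a + b ≤ n.  Every lattice segment in one of the three net
-- directions lies on a segment of the net.  Affine maps preserve convexity
-- and (for positive determinant) orientation, so the count is the same as
-- for any concrete triangle.

Point : Set
Point = ℤ × ℤ

netVertices : ℕ → List Point
netVertices n =
  concatMap (λ a → map (λ b → (+ a , + b)) (upTo (suc (n ℕ.∸ a)))) (upTo (suc n))

_⊖_ : Point → Point → Point
(a , b) ⊖ (c , d) = (a - c , b - d)

cross : Point → Point → ℤ
cross (x₁ , y₁) (x₂ , y₂) = x₁ * y₂ - y₁ * x₂

NetDirection : Point → Set
NetDirection (x , y) =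
  ¬ ((x , y) ≡ (+ 0 , + 0)) × (x ≡ + 0 ⊎ y ≡ + 0 ⊎ x + y ≡ + 0)

next : Fin 5 → Fin 5
next f0 = fs f0
next (fs f0) = fs (fs f0)
next (fs (fs f0)) = fs (fs (fs f0))
next (fs (fs (fs f0))) = fs (fs (fs (fs f0)))
next (fs (fs (fs (fs f0)))) = f0

_≤lex_ : Point → Point → Set
(a , b) ≤lex (c , d) = a < c ⊎ (a ≡ c × b ≤ d)

-- v 0, v 1, ..., v 4 are the vertices, listed counterclockwise, of a
-- convex pentagon (all interior angles < π) whose sides lie on the net:
--  * every side v i → v (next i) is a nonzero vector in a net direction;
--  * every vertex other than the two endpoints of a side lies strictly to
--    the left of (the line of) that side  [strict convexity, ccw order].
-- To count each pentagon exactly once we require v 0 to be the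
-- lexicographically smallest vertex (this fixes the starting vertex;
-- counterclockwise orientation fixes the direction).
IsNetConvexPentagon : Vector Point 5 → Set
IsNetConvexPentagon v =
  (∀ i → NetDirection (v (next i) ⊖ v i)) ×
  (∀ i → ∀ j → j ≢ i → j ≢ next i →
     + 0 < cross (v (next i) ⊖ v i) (v j ⊖ v i)) ×
  (∀ j → v f0 ≤lex v j)

private
  decPt : (p q : Point) → Dec (p ≡ q)
  decPt (a , b) (c , d) = Data.Product.Properties.≡-dec ℤP._≟_ ℤP._≟_ (a , b) (c , d)
    where import Data.Product.Properties

  decFin : (i j : Fin 5) → Dec (i ≡ j)
  decFin = Data.Fin.Properties._≟_

  netDir? : ∀ p → Dec (NetDirection p)
  netDir? (x , y) = ¬? (decPt (x , y) (+ 0 , + 0)) ×-dec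
    ((x ℤP.≟ + 0) ⊎-dec ((y ℤP.≟ + 0) ⊎-dec ((x + y) ℤP.≟ + 0)))

  lex? : ∀ p q → Dec (p ≤lex q)
  lex? (a , b) (c , d) = (a ℤP.<? c) ⊎-dec ((a ℤP.≟ c) ×-dec (b ℤP.≤? d))

  impl? : {A B : Set} → Dec A → Dec B → Dec (A → B)
  impl? = Relation.Nullary.Decidable._→-dec_
    where import Relation.Nullary.Decidable

isNetConvexPentagon? : ∀ v → Dec (IsNetConvexPentagon v)
isNetConvexPentagon? v =
  all? (λ i → netDir? (v (next i) ⊖ v i)) ×-dec
  (all? (λ i → all? (λ j → impl? (¬? (decFin j i)) (impl? (¬? (decFin j (next i)))
     (ℤ.+ 0 ℤP.<? cross (v (next i) ⊖ v i) (v j ⊖ v i)))))) ×-dec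
  all? (λ j → lex? (v f0) (v j))

tuples5 : {A : Set} → List A → List (Vector A 5)
tuples5 xs =
  concatMap (λ a → concatMap (λ b → concatMap (λ c → concatMap (λ d → map (λ e →
    mk a b c d e) xs) xs) xs) xs) xs
  where
  mk : {A : Set} → A → A → A → A → A → Vector A 5
  mk a b c d e f0 = a
  mk a b c d e (fs f0) = b
  mk a b c d e (fs (fs f0)) = c
  mk a b c d e (fs (fs (fs f0))) = d
  mk a b c d e (fs (fs (fs (fs f0)))) = e

P : ℕ → ℕ
P n = length (filter isNetConvexPentagon? (tuples5 (netVertices n)))

module Submission where

-- In lattice coordinates the net vertices are the points (x , y) ∈ ℕ² with x + y ≤ n,
-- and every side of a net polygon points in one of six directions d0 … d5. Walking
-- around a convex pentagon from its lexicographically least vertex, each side turns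
-- left from the previous one by 60° or 120°, so its five directions are all six but
-- one, the omitted direction o (turn-pattern); conversely every closed walk following
-- such a pattern is a convex pentagon (walk⇒pentagon, via convex-from-turns). For a
-- fixed o the closing condition leaves five natural parameters (corners,
-- walk⇒corners), and the pentagon lies in the n-net iff its highest vertex does: the
-- parameters range over a simplex (o = d5, d3, d1) or a skew simplex (o = d4, d2, d0).
-- The parameters can be read back from the pentagon (decode), so P n counts them
-- (P≡pentagonCount), and the closed forms of the two sizes give the theorem.

module Counting where

  open import Data.Nat using (ℕ; suc; _+_)
  open import Data.Product using (_×_; _,_)
  open import Data.List using (List; []; _∷_; map; concatMap; length; filter; _++_; cartesianProduct)
  open import Data.List.Properties using (length-++; filter-++)
  open import Data.List.Membership.Propositional using (_∈_; find)
  open import Data.List.Membership.Propositional.Properties using (∈-concatMap⁻)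
  import Data.List.Relation.Unary.All as All
  open import Data.List.Relation.Unary.Unique.Propositional using (Unique)
  open import Data.List.Relation.Unary.AllPairs using ([]; _∷_)
  import Data.List.Relation.Unary.Unique.Propositional.Properties as Unique
  open import Data.List.Membership.Propositional.Properties.WithK using (unique∧set⇒bag)
  open import Data.List.Relation.Binary.BagAndSetEquality using (∼bag⇒↭)
  open import Data.List.Relation.Binary.Permutation.Propositional.Properties using (↭-length)
  open import Relation.Binary.PropositionalEquality
  open import Relation.Nullary using (¬_; Dec; yes; no)
  open import Data.Empty using (⊥-elim)
  open import Function using (mk⇔)

  count : {A : Set} {P : A → Set} → (∀ x → Dec (P x)) → List A → ℕ
  count P? xs = length (filter P? xs)

  module _ {A : Set} {P : A → Set} (P? : ∀ x → Dec (P x)) where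

    count-++ : ∀ xs ys → count P? (xs ++ ys) ≡ count P? xs + count P? ys
    count-++ xs ys = trans (cong length (filter-++ P? xs ys)) (length-++ (filter P? xs))

    count-map : {B : Set} (f : B → A) → ∀ xs → count P? (map f xs) ≡ count (λ x → P? (f x)) xs
    count-map f [] = refl
    count-map f (x ∷ xs) with P? (f x)
    ... | yes _ = cong suc (count-map f xs)
    ... | no _ = count-map f xs

  count-⇔ : {A : Set} {P Q : A → Set} (P? : ∀ x → Dec (P x)) (Q? : ∀ x → Dec (Q x)) →
            (∀ x → P x → Q x) → (∀ x → Q x → P x) → ∀ xs → count P? xs ≡ count Q? xs
  count-⇔ P? Q? to from [] = refl
  count-⇔ P? Q? to from (x ∷ xs) with P? x | Q? x
  ... | yes _ | yes _ = cong suc (count-⇔ P? Q? to from xs)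
  ... | yes p | no ¬q = ⊥-elim (¬q (to x p))
  ... | no ¬p | yes q = ⊥-elim (¬p (from x q))
  ... | no _  | no _  = count-⇔ P? Q? to from xs

  count-cartesian : {A B C : Set} {P : C → Set} {Q : A × B → Set}
    (P? : ∀ x → Dec (P x)) (Q? : ∀ x → Dec (Q x)) {F : A → List C} {ys : List B} →
    (∀ a → count P? (F a) ≡ count (λ y → Q? (a , y)) ys) →
    ∀ xs → count P? (concatMap F xs) ≡ count Q? (cartesianProduct xs ys)
  count-cartesian P? Q? {F} {ys} fibre [] = refl
  count-cartesian P? Q? {F} {ys} fibre (a ∷ as) = begin
    count P? (F a ++ concatMap F as)
      ≡⟨ count-++ P? (F a) (concatMap F as) ⟩
    count P? (F a) + count P? (concatMap F as)
      ≡⟨ cong₂ _+_ (trans (fibre a) (sym (count-map Q? (a ,_) ys))) (count-cartesian P? Q? fibre as) ⟩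
    count Q? (map (a ,_) ys) + count Q? (cartesianProduct as ys)
      ≡⟨ sym (count-++ Q? (map (a ,_) ys) (cartesianProduct as ys)) ⟩
    count Q? (cartesianProduct (a ∷ as) ys) ∎
    where open ≡-Reasoning

  unique-length : {A : Set} {xs ys : List A} → Unique xs → Unique ys →
                  (∀ {z} → z ∈ xs → z ∈ ys) → (∀ {z} → z ∈ ys → z ∈ xs) → length xs ≡ length ys
  unique-length ux uy to from = ↭-length (∼bag⇒↭ (unique∧set⇒bag ux uy (mk⇔ to from)))

  unique-concatMap : {A B : Set} (key : B → A) (f : A → List B) {xs : List A} → Unique xs →
                     (∀ a → Unique (f a)) → (∀ a b → b ∈ f a → key b ≡ a) → Unique (concatMap f xs)
  unique-concatMap key f {[]} _ _ _ = []
  unique-concatMap key f {a ∷ as} (a∉ ∷ u) uf keyed =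
    Unique.++⁺ (uf a) (unique-concatMap key f u uf keyed) disjoint
    where
    disjoint : ∀ {b} → ¬ (b ∈ f a × b ∈ concatMap f as)
    disjoint {b} (b∈fa , b∈rest) with find (∈-concatMap⁻ f {xs = as} b∈rest)
    ... | a' , a'∈as , b∈fa' = All.lookup a∉ a'∈as (trans (sym (keyed a b b∈fa)) (keyed a' b b∈fa'))

module NetTuples where

  open import Defs
  open Counting
  open import Data.Nat as ℕ using (ℕ; suc; _+_; _≤_; _∸_)
  import Data.Nat.Properties as ℕP
  open import Data.Integer as ℤ using (+_)
  open import Data.Product using (_×_; _,_; proj₁; ∃-syntax)
  open import Data.Fin using (Fin) renaming (zero to f0; suc to fs)
  open import Data.List using (List; map; upTo; cartesianProduct)
  open import Data.List.Membership.Propositional using (_∈_; find)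
  open import Data.List.Membership.Propositional.Properties
    using (∈-map⁺; ∈-map⁻; ∈-concatMap⁺; ∈-concatMap⁻; ∈-upTo⁺; ∈-upTo⁻; ∈-cartesianProduct⁺; ∈-cartesianProduct⁻)
  import Data.List.Relation.Unary.Any as Any
  open import Data.List.Relation.Unary.Unique.Propositional using (Unique)
  import Data.List.Relation.Unary.Unique.Propositional.Properties as Unique
  open import Data.Vec.Functional using (Vector)
  open import Relation.Binary.PropositionalEquality
  open import Relation.Nullary using (Dec)

  -- Five-tuples of points, the concrete form of a vertex list Vector Point 5
  -- (unlike functions, tuples have a decidable, injective equality).
  Tup : Set
  Tup = Point × Point × Point × Point × Point

  vertex : Tup → Vector Point 5
  vertex (p₀ , p₁ , p₂ , p₃ , p₄) f0 = p₀
  vertex (p₀ , p₁ , p₂ , p₃ , p₄) (fs f0) = p₁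
  vertex (p₀ , p₁ , p₂ , p₃ , p₄) (fs (fs f0)) = p₂
  vertex (p₀ , p₁ , p₂ , p₃ , p₄) (fs (fs (fs f0))) = p₃
  vertex (p₀ , p₁ , p₂ , p₃ , p₄) (fs (fs (fs (fs f0)))) = p₄

  IsPentagon : Tup → Set
  IsPentagon t = IsNetConvexPentagon (vertex t)

  isPentagon? : ∀ t → Dec (IsPentagon t)
  isPentagon? t = isNetConvexPentagon? (vertex t)

  tuples : {A : Set} → List A → List (A × A × A × A × A)
  tuples xs = cartesianProduct xs (cartesianProduct xs (cartesianProduct xs (cartesianProduct xs xs)))

  pentagon-resp : ∀ (v w : Vector Point 5) → (∀ i → v i ≡ w i) →
                  IsNetConvexPentagon v → IsNetConvexPentagon w
  pentagon-resp v w v≗w (sides , convex , lexMin) =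
    (λ i → subst₂ (λ p q → NetDirection (p ⊖ q)) (v≗w (next i)) (v≗w i) (sides i)) ,
    (λ i j j≢i j≢next → subst₂ (λ p q → ℤ.+ 0 ℤ.< cross (p ⊖ q) (w j ⊖ w i)) (v≗w (next i)) (v≗w i)
       (subst₂ (λ q r → ℤ.+ 0 ℤ.< cross (v (next i) ⊖ v i) (r ⊖ q)) (v≗w i) (v≗w j) (convex i j j≢i j≢next))) ,
    (λ j → subst₂ _≤lex_ (v≗w f0) (v≗w j) (lexMin j))

  count-tuples5 : ∀ xs → count isNetConvexPentagon? (tuples5 xs) ≡ count isPentagon? (tuples xs)
  count-tuples5 xs =
    count-cartesian P? isPentagon? (λ a →
    count-cartesian P? (λ y → isPentagon? (a , y)) (λ b →
    count-cartesian P? (λ y → isPentagon? (a , b , y)) (λ c →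
    count-cartesian P? (λ y → isPentagon? (a , b , c , y)) (λ d →
    fibre a b c d (λ e → λ { f0 → refl ; (fs f0) → refl ; (fs (fs f0)) → refl ; (fs (fs (fs f0))) → refl
                           ; (fs (fs (fs (fs f0)))) → refl }) xs) xs) xs) xs) xs
    where
    P? = isNetConvexPentagon?
    fibre : ∀ a b c d {mk : Point → Vector Point 5} → (∀ e i → mk e i ≡ vertex (a , b , c , d , e) i) →
            ∀ es → count P? (map mk es) ≡ count (λ e → isPentagon? (a , b , c , d , e)) es
    fibre a b c d {mk} mk≗ es = trans (count-map P? mk es)
      (count-⇔ _ _ (λ e → pentagon-resp _ _ (mk≗ e)) (λ e → pentagon-resp _ _ (λ i → sym (mk≗ e i))) es)

  tuples-unique : {A : Set} {xs : List A} → Unique xs → Unique (tuples xs)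
  tuples-unique u = Unique.cartesianProduct⁺ u (Unique.cartesianProduct⁺ u
                      (Unique.cartesianProduct⁺ u (Unique.cartesianProduct⁺ u u)))

  ∈-tuples⁻ : {A : Set} {xs : List A} {a b c d e : A} → (a , b , c , d , e) ∈ tuples xs →
              a ∈ xs × b ∈ xs × c ∈ xs × d ∈ xs × e ∈ xs
  ∈-tuples⁻ {xs = xs} t∈ with ∈-cartesianProduct⁻ xs _ t∈
  ... | a∈ , t∈₁ with ∈-cartesianProduct⁻ xs _ t∈₁
  ... | b∈ , t∈₂ with ∈-cartesianProduct⁻ xs _ t∈₂
  ... | c∈ , t∈₃ with ∈-cartesianProduct⁻ xs xs t∈₃
  ... | d∈ , e∈ = a∈ , b∈ , c∈ , d∈ , e∈

  ∈-tuples⁺ : {A : Set} {xs : List A} {a b c d e : A} →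
              a ∈ xs → b ∈ xs → c ∈ xs → d ∈ xs → e ∈ xs → (a , b , c , d , e) ∈ tuples xs
  ∈-tuples⁺ a∈ b∈ c∈ d∈ e∈ =
    ∈-cartesianProduct⁺ a∈ (∈-cartesianProduct⁺ b∈ (∈-cartesianProduct⁺ c∈ (∈-cartesianProduct⁺ d∈ e∈)))

  NPoint : Set
  NPoint = ℕ × ℕ

  pt : NPoint → Point
  pt (x , y) = (+ x , + y)

  height : NPoint → ℕ
  height (x , y) = x + y

  column : ℕ → ℕ → List Point
  column n a = map (λ b → (+ a , + b)) (upTo (suc (n ∸ a)))

  netVertices-unique : ∀ n → Unique (netVertices n)
  netVertices-unique n =
    unique-concatMap (λ p → ℤ.∣ proj₁ p ∣) (column n) (Unique.upTo⁺ (suc n))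
      (λ a → Unique.map⁺ (λ { refl → refl }) (Unique.upTo⁺ _)) column-key
    where
    column-key : ∀ a p → p ∈ column n a → ℤ.∣ proj₁ p ∣ ≡ a
    column-key a p p∈ with ∈-map⁻ (λ b → (+ a , + b)) p∈
    ... | b , _ , refl = refl

  ∈-netVertices⁺ : ∀ {n} q → height q ≤ n → pt q ∈ netVertices n
  ∈-netVertices⁺ {n} (a , b) a+b≤n =
    ∈-concatMap⁺ (column n) (Any.map (λ { refl → ∈-map⁺ (λ b → (+ a , + b)) (∈-upTo⁺ b<) }) a∈)
    where
    a∈ : a ∈ upTo (suc n)
    a∈ = ∈-upTo⁺ (ℕ.s≤s (ℕP.m+n≤o⇒m≤o a a+b≤n))
    b< : b ℕ.< suc (n ∸ a)
    b< = ℕ.s≤s (ℕP.m+n≤o⇒m≤o∸n b (subst (_≤ n) (ℕP.+-comm a b) a+b≤n))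

  ∈-netVertices⁻ : ∀ {n p} → p ∈ netVertices n → ∃[ q ] p ≡ pt q × height q ≤ n
  ∈-netVertices⁻ {n} p∈ with find (∈-concatMap⁻ (column n) {xs = upTo (suc n)} p∈)
  ... | a , a∈ , p∈column with ∈-map⁻ (λ b → (+ a , + b)) p∈column
  ... | b , b∈ , refl = (a , b) , refl , a+b≤n
    where
    a+b≤n : a + b ≤ n
    a+b≤n = subst (a + b ≤_) (ℕP.m+[n∸m]≡n (ℕP.≤-pred (∈-upTo⁻ a∈)))
              (ℕP.+-monoʳ-≤ a (ℕP.≤-pred (∈-upTo⁻ b∈)))

module Simplices where

  open import Data.Nat as ℕ using (ℕ; zero; suc; _+_; _*_; _≤_; z≤n; s≤s; _!)
  import Data.Nat.Properties as ℕP
  open import Data.Nat.Tactic.RingSolver using (solve-∀)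
  open import Data.Product using (_,_)
  open import Data.Sum using (inj₁; inj₂)
  open import Data.Vec using (Vec; []; _∷_; sum)
  open import Data.Vec.Properties using (∷-injectiveʳ)
  open import Data.List using (List; []; _∷_; map; length; _++_)
  open import Data.List.Properties using (length-++; length-map)
  open import Data.List.Membership.Propositional using (_∈_)
  open import Data.List.Membership.Propositional.Properties using (∈-map⁺; ∈-map⁻; ∈-++⁺ˡ; ∈-++⁺ʳ; ∈-++⁻)
  open import Data.List.Relation.Unary.Any using (here)
  open import Data.List.Relation.Unary.Unique.Propositional using (Unique)
  open import Data.List.Relation.Unary.AllPairs using ([]; _∷_)
  import Data.List.Relation.Unary.All as All
  import Data.List.Relation.Unary.Unique.Propositional.Properties as Unique
  open import Relation.Binary.PropositionalEquality
  open import Data.Empty using (⊥)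

  bump : ∀ {k} → Vec ℕ (suc k) → Vec ℕ (suc k)
  bump (a ∷ v) = suc a ∷ v

  bump-injective : ∀ {k} {v w : Vec ℕ (suc k)} → bump v ≡ bump w → v ≡ w
  bump-injective {v = _ ∷ _} {_ ∷ _} refl = refl

  zero-head-bump-disjoint : ∀ {k} (xs : List (Vec ℕ k)) (ys : List (Vec ℕ (suc k))) {v} →
                            v ∈ map (0 ∷_) xs → v ∈ map bump ys → ⊥
  zero-head-bump-disjoint xs ys p q with ∈-map⁻ (0 ∷_) p | ∈-map⁻ bump q
  ... | _ , _ , refl | (_ ∷ _) , _ , ()

  simplex : (k m : ℕ) → List (Vec ℕ k)
  simplex zero m = [] ∷ []
  simplex (suc k) zero = map (0 ∷_) (simplex k 0)
  simplex (suc k) (suc m) = map (0 ∷_) (simplex k (suc m)) ++ map bump (simplex (suc k) m)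

  ∈-simplex⁺ : ∀ k m (v : Vec ℕ k) → sum v ≤ m → v ∈ simplex k m
  ∈-simplex⁺ zero m [] _ = here refl
  ∈-simplex⁺ (suc k) zero (zero ∷ w) le = ∈-map⁺ (0 ∷_) (∈-simplex⁺ k 0 w le)
  ∈-simplex⁺ (suc k) (suc m) (zero ∷ w) le = ∈-++⁺ˡ (∈-map⁺ (0 ∷_) (∈-simplex⁺ k (suc m) w le))
  ∈-simplex⁺ (suc k) (suc m) (suc a ∷ w) (s≤s le) = ∈-++⁺ʳ _ (∈-map⁺ bump (∈-simplex⁺ (suc k) m (a ∷ w) le))

  ∈-simplex⁻ : ∀ k m (v : Vec ℕ k) → v ∈ simplex k m → sum v ≤ m
  ∈-simplex⁻ zero m [] _ = z≤n
  ∈-simplex⁻ (suc k) zero v v∈ with ∈-map⁻ (0 ∷_) v∈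
  ... | w , w∈ , refl = ∈-simplex⁻ k 0 w w∈
  ∈-simplex⁻ (suc k) (suc m) v v∈ with ∈-++⁻ (map (0 ∷_) (simplex k (suc m))) v∈
  ... | inj₁ v∈₀ with ∈-map⁻ (0 ∷_) v∈₀
  ...   | w , w∈ , refl = ∈-simplex⁻ k (suc m) w w∈
  ∈-simplex⁻ (suc k) (suc m) v v∈ | inj₂ v∈₁ with ∈-map⁻ bump v∈₁
  ...   | (a ∷ w) , w∈ , refl = s≤s (∈-simplex⁻ (suc k) m (a ∷ w) w∈)

  simplex-unique : ∀ k m → Unique (simplex k m)
  simplex-unique zero m = All.[] ∷ []
  simplex-unique (suc k) zero = Unique.map⁺ ∷-injectiveʳ (simplex-unique k 0)
  simplex-unique (suc k) (suc m) =
    Unique.++⁺ (Unique.map⁺ ∷-injectiveʳ (simplex-unique k (suc m)))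
               (Unique.map⁺ bump-injective (simplex-unique (suc k) m))
               (λ (p , q) → zero-head-bump-disjoint _ _ p q)

  -- Its size, by the same (Pascal) recursion; it equals the binomial C(m+k, k).
  simplexSize : ℕ → ℕ → ℕ
  simplexSize zero m = 1
  simplexSize (suc k) zero = simplexSize k 0
  simplexSize (suc k) (suc m) = simplexSize k (suc m) + simplexSize (suc k) m

  simplex-length : ∀ k m → length (simplex k m) ≡ simplexSize k m
  simplex-length zero m = refl
  simplex-length (suc k) zero = trans (length-map (0 ∷_) (simplex k 0)) (simplex-length k 0)
  simplex-length (suc k) (suc m) = trans (length-++ (map (0 ∷_) (simplex k (suc m))))
    (cong₂ _+_ (trans (length-map (0 ∷_) (simplex k (suc m))) (simplex-length k (suc m)))
               (trans (length-map bump (simplex (suc k) m)) (simplex-length (suc k) m)))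

  rising : ℕ → ℕ → ℕ
  rising m zero = 1
  rising m (suc k) = rising m k * (m + suc k)

  rising-shift : ∀ m k → rising m (suc k) ≡ suc m * rising (suc m) k
  rising-shift m zero = base m
    where
    base : ∀ m → 1 * (m + 1) ≡ suc m * 1
    base = solve-∀
  rising-shift m (suc k) = begin
    rising m (suc k) * (m + suc (suc k))      ≡⟨ cong (_* (m + suc (suc k))) (rising-shift m k) ⟩
    suc m * rising (suc m) k * (m + suc (suc k)) ≡⟨ regroup m k (rising (suc m) k) ⟩
    suc m * (rising (suc m) k * (suc m + suc k)) ∎
    where
    open ≡-Reasoning
    regroup : ∀ m k r → suc m * r * (m + suc (suc k)) ≡ suc m * (r * (suc m + suc k))
    regroup = solve-∀

  simplexSize-closed : ∀ k m → k ! * simplexSize k m ≡ rising m k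
  simplexSize-closed zero m = refl
  simplexSize-closed (suc k) zero = begin
    suc k ! * simplexSize k 0      ≡⟨ ℕP.*-assoc (suc k) (k !) (simplexSize k 0) ⟩
    suc k * (k ! * simplexSize k 0) ≡⟨ cong (suc k *_) (simplexSize-closed k 0) ⟩
    suc k * rising 0 k             ≡⟨ ℕP.*-comm (suc k) (rising 0 k) ⟩
    rising 0 (suc k)               ∎
    where open ≡-Reasoning
  simplexSize-closed (suc k) (suc m) = begin
    suc k ! * (simplexSize k (suc m) + simplexSize (suc k) m)
      ≡⟨ split k (k !) (simplexSize k (suc m)) (simplexSize (suc k) m) ⟩
    suc k * (k ! * simplexSize k (suc m)) + suc k ! * simplexSize (suc k) m
      ≡⟨ cong₂ (λ x y → suc k * x + y) (simplexSize-closed k (suc m)) (simplexSize-closed (suc k) m) ⟩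
    suc k * rising (suc m) k + rising m (suc k)
      ≡⟨ cong (suc k * rising (suc m) k +_) (rising-shift m k) ⟩
    suc k * rising (suc m) k + suc m * rising (suc m) k
      ≡⟨ pascal k m (rising (suc m) k) ⟩
    rising (suc m) (suc k) ∎
    where
    open ≡-Reasoning
    split : ∀ k f a b → (suc k * f) * (a + b) ≡ suc k * (f * a) + (suc k * f) * b
    split = solve-∀
    pascal : ∀ k m r → suc k * r + suc m * r ≡ r * (suc m + suc k)
    pascal = solve-∀

  skewSimplex : (k m : ℕ) → List (Vec ℕ (suc k))
  skewSimplex k zero = map (0 ∷_) (simplex k 0)
  skewSimplex k (suc zero) = map (0 ∷_) (simplex k 1)
  skewSimplex k (suc (suc m)) = map (0 ∷_) (simplex k (suc (suc m))) ++ map bump (skewSimplex k m)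

  ∈-skewSimplex⁺ : ∀ k m c (w : Vec ℕ k) → c + c + sum w ≤ m → (c ∷ w) ∈ skewSimplex k m
  ∈-skewSimplex⁺ k zero zero w le = ∈-map⁺ (0 ∷_) (∈-simplex⁺ k 0 w le)
  ∈-skewSimplex⁺ k (suc zero) zero w le = ∈-map⁺ (0 ∷_) (∈-simplex⁺ k 1 w le)
  ∈-skewSimplex⁺ k (suc zero) (suc c) w (s≤s le) rewrite ℕP.+-suc c c with le
  ... | ()
  ∈-skewSimplex⁺ k (suc (suc m)) zero w le = ∈-++⁺ˡ (∈-map⁺ (0 ∷_) (∈-simplex⁺ k (suc (suc m)) w le))
  ∈-skewSimplex⁺ k (suc (suc m)) (suc c) w (s≤s le) rewrite ℕP.+-suc c c with le
  ... | s≤s le′ = ∈-++⁺ʳ _ (∈-map⁺ bump (∈-skewSimplex⁺ k m c w le′))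

  ∈-skewSimplex⁻ : ∀ k m c (w : Vec ℕ k) → (c ∷ w) ∈ skewSimplex k m → c + c + sum w ≤ m
  ∈-skewSimplex⁻ k zero c w v∈ with ∈-map⁻ (0 ∷_) v∈
  ... | u , u∈ , refl = ∈-simplex⁻ k 0 u u∈
  ∈-skewSimplex⁻ k (suc zero) c w v∈ with ∈-map⁻ (0 ∷_) v∈
  ... | u , u∈ , refl = ∈-simplex⁻ k 1 u u∈
  ∈-skewSimplex⁻ k (suc (suc m)) c w v∈ with ∈-++⁻ (map (0 ∷_) (simplex k (suc (suc m)))) v∈
  ... | inj₁ v∈₀ with ∈-map⁻ (0 ∷_) v∈₀
  ...   | u , u∈ , refl = ∈-simplex⁻ k (suc (suc m)) u u∈
  ∈-skewSimplex⁻ k (suc (suc m)) c w v∈ | inj₂ v∈₁ with ∈-map⁻ bump v∈₁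
  ...   | (c′ ∷ u) , u∈ , refl rewrite ℕP.+-suc c′ c′ = s≤s (s≤s (∈-skewSimplex⁻ k m c′ u u∈))

  skewSimplex-unique : ∀ k m → Unique (skewSimplex k m)
  skewSimplex-unique k zero = Unique.map⁺ ∷-injectiveʳ (simplex-unique k 0)
  skewSimplex-unique k (suc zero) = Unique.map⁺ ∷-injectiveʳ (simplex-unique k 1)
  skewSimplex-unique k (suc (suc m)) =
    Unique.++⁺ (Unique.map⁺ ∷-injectiveʳ (simplex-unique k (suc (suc m))))
               (Unique.map⁺ bump-injective (skewSimplex-unique k m))
               (λ (p , q) → zero-head-bump-disjoint _ _ p q)

  skewSize : ℕ → ℕ → ℕ
  skewSize k zero = simplexSize k 0
  skewSize k (suc zero) = simplexSize k 1
  skewSize k (suc (suc m)) = simplexSize k (suc (suc m)) + skewSize k m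

  skewSimplex-length : ∀ k m → length (skewSimplex k m) ≡ skewSize k m
  skewSimplex-length k zero = trans (length-map (0 ∷_) (simplex k 0)) (simplex-length k 0)
  skewSimplex-length k (suc zero) = trans (length-map (0 ∷_) (simplex k 1)) (simplex-length k 1)
  skewSimplex-length k (suc (suc m)) = trans (length-++ (map (0 ∷_) (simplex k (suc (suc m)))))
    (cong₂ _+_ (trans (length-map (0 ∷_) (simplex k (suc (suc m)))) (simplex-length k (suc (suc m))))
               (trans (length-map bump (skewSimplex k m)) (skewSimplex-length k m)))

module ClosedForms where

  open Simplices
  open import Data.Nat as ℕ using (ℕ; zero; suc; _!)
  import Data.Nat.Properties as ℕP
  open import Data.Integer using (ℤ; +_; _+_; _*_; _-_; _^_)
  import Data.Nat.Tactic.RingSolver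
  import Data.Integer.Properties as ℤP
  open import Data.Integer.Tactic.RingSolver using (solve-∀)
  open import Relation.Binary.PropositionalEquality

  risingℤ : ℤ → ℕ → ℤ
  risingℤ M zero = + 1
  risingℤ M (suc k) = risingℤ M k * (M + + suc k)

  rising-cast : ∀ m k → + rising m k ≡ risingℤ (+ m) k
  rising-cast m zero = refl
  rising-cast m (suc k) =
    trans (ℤP.pos-* (rising m k) (m ℕ.+ suc k)) (cong₂ _*_ (rising-cast m k) (ℤP.pos-+ m (suc k)))

  simplexSize-poly : ∀ k m → + (k !) * + simplexSize k m ≡ risingℤ (+ m) k
  simplexSize-poly k m =
    trans (sym (ℤP.pos-* (k !) (simplexSize k m))) (trans (cong +_ (simplexSize-closed k m)) (rising-cast m k))

  skewEven skewOdd : ℤ → ℤ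
  skewEven J = + 30 + + 121 * J + + 175 * (J * J) + + 115 * (J * J * J) + + 35 * (J * J * J * J) + + 4 * (J * J * J * J * J)
  skewOdd J = + 150 + + 401 * J + + 405 * (J * J) + + 195 * (J * J * J) + + 45 * (J * J * J * J) + + 4 * (J * J * J * J * J)

  skewSize-step : ∀ m → + 4 * (+ 30 * + skewSize 4 (suc (suc m)))
                        ≡ + 5 * risingℤ (+ suc (suc m)) 4 + + 4 * (+ 30 * + skewSize 4 m)
  skewSize-step m = begin
    + 4 * (+ 30 * + (simplexSize 4 (suc (suc m)) ℕ.+ skewSize 4 m))
      ≡⟨ cong (λ x → + 4 * (+ 30 * x)) (ℤP.pos-+ (simplexSize 4 (suc (suc m))) (skewSize 4 m)) ⟩
    + 4 * (+ 30 * (+ simplexSize 4 (suc (suc m)) + + skewSize 4 m))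
      ≡⟨ distribute (+ simplexSize 4 (suc (suc m))) (+ skewSize 4 m) ⟩
    + 5 * (+ 24 * + simplexSize 4 (suc (suc m))) + + 4 * (+ 30 * + skewSize 4 m)
      ≡⟨ cong (λ x → + 5 * x + + 4 * (+ 30 * + skewSize 4 m)) (simplexSize-poly 4 (suc (suc m))) ⟩
    + 5 * risingℤ (+ suc (suc m)) 4 + + 4 * (+ 30 * + skewSize 4 m) ∎
    where
    open ≡-Reasoning
    distribute : ∀ X Y → + 4 * (+ 30 * (X + Y)) ≡ + 5 * (+ 24 * X) + + 4 * (+ 30 * Y)
    distribute = solve-∀

  skewSize-even : ∀ j → + 30 * + skewSize 4 (j ℕ.+ j) ≡ skewEven (+ j)
  skewSize-even zero = refl
  skewSize-even (suc j) rewrite ℕP.+-suc j j = ℤP.*-cancelˡ-≡ (+ 4) _ _ (begin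
    + 4 * (+ 30 * + skewSize 4 (suc (suc (j ℕ.+ j))))
      ≡⟨ skewSize-step (j ℕ.+ j) ⟩
    + 5 * risingℤ (+ 2 + (+ j + + j)) 4 + + 4 * (+ 30 * + skewSize 4 (j ℕ.+ j))
      ≡⟨ cong (λ x → + 5 * risingℤ (+ 2 + (+ j + + j)) 4 + + 4 * x) (skewSize-even j) ⟩
    + 5 * risingℤ (+ 2 + (+ j + + j)) 4 + + 4 * skewEven (+ j)
      ≡⟨ identity (+ j) ⟩
    + 4 * skewEven (+ 1 + + j) ∎)
    where
    open ≡-Reasoning
    identity : ∀ J → + 5 * (+ 1 * (+ 2 + (J + J) + + 1) * (+ 2 + (J + J) + + 2) * (+ 2 + (J + J) + + 3) * (+ 2 + (J + J) + + 4))
                      + + 4 * (+ 30 + + 121 * J + + 175 * (J * J) + + 115 * (J * J * J) + + 35 * (J * J * J * J) + + 4 * (J * J * J * J * J))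
                ≡ + 4 * (+ 30 + + 121 * (+ 1 + J) + + 175 * ((+ 1 + J) * (+ 1 + J)) + + 115 * ((+ 1 + J) * (+ 1 + J) * (+ 1 + J))
                         + + 35 * ((+ 1 + J) * (+ 1 + J) * (+ 1 + J) * (+ 1 + J)) + + 4 * ((+ 1 + J) * (+ 1 + J) * (+ 1 + J) * (+ 1 + J) * (+ 1 + J)))
    identity = solve-∀

  skewSize-odd : ∀ j → + 30 * + skewSize 4 (suc (j ℕ.+ j)) ≡ skewOdd (+ j)
  skewSize-odd zero = refl
  skewSize-odd (suc j) rewrite ℕP.+-suc j j = ℤP.*-cancelˡ-≡ (+ 4) _ _ (begin
    + 4 * (+ 30 * + skewSize 4 (suc (suc (suc (j ℕ.+ j)))))
      ≡⟨ skewSize-step (suc (j ℕ.+ j)) ⟩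
    + 5 * risingℤ (+ 3 + (+ j + + j)) 4 + + 4 * (+ 30 * + skewSize 4 (suc (j ℕ.+ j)))
      ≡⟨ cong (λ x → + 5 * risingℤ (+ 3 + (+ j + + j)) 4 + + 4 * x) (skewSize-odd j) ⟩
    + 5 * risingℤ (+ 3 + (+ j + + j)) 4 + + 4 * skewOdd (+ j)
      ≡⟨ identity (+ j) ⟩
    + 4 * skewOdd (+ 1 + + j) ∎)
    where
    open ≡-Reasoning
    identity : ∀ J → + 5 * (+ 1 * (+ 3 + (J + J) + + 1) * (+ 3 + (J + J) + + 2) * (+ 3 + (J + J) + + 3) * (+ 3 + (J + J) + + 4))
                      + + 4 * (+ 150 + + 401 * J + + 405 * (J * J) + + 195 * (J * J * J) + + 45 * (J * J * J * J) + + 4 * (J * J * J * J * J))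
                ≡ + 4 * (+ 150 + + 401 * (+ 1 + J) + + 405 * ((+ 1 + J) * (+ 1 + J)) + + 195 * ((+ 1 + J) * (+ 1 + J) * (+ 1 + J))
                         + + 45 * ((+ 1 + J) * (+ 1 + J) * (+ 1 + J) * (+ 1 + J)) + + 4 * ((+ 1 + J) * (+ 1 + J) * (+ 1 + J) * (+ 1 + J) * (+ 1 + J)))
    identity = solve-∀

  -- The number of pentagons predicted by the parametrisation: three omitted
  -- directions whose pentagons are indexed by the simplex of size C(n+2, 5), and
  -- three whose pentagons are indexed by the skew simplex for m = n - 4.
  upCount downCount pentagonCount : ℕ → ℕ
  upCount (suc (suc (suc m))) = simplexSize 5 m
  upCount _ = 0
  downCount (suc (suc (suc (suc m)))) = skewSize 4 m
  downCount _ = 0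
  pentagonCount n = 3 ℕ.* upCount n ℕ.+ 3 ℕ.* downCount n

  private
    scaled-count : ∀ U D → + 120 * (+ 10 * + (3 ℕ.* U ℕ.+ 3 ℕ.* D))
                           ≡ + 30 * (+ 120 * + U) + + 120 * (+ 30 * + D)
    scaled-count U D = trans (cong (λ x → + 120 * (+ 10 * x)) (trans (ℤP.pos-+ (3 ℕ.* U) (3 ℕ.* D))
                               (cong₂ _+_ (ℤP.pos-* 3 U) (ℤP.pos-* 3 D))))
                             (regroup (+ U) (+ D))
      where
      regroup : ∀ U D → + 120 * (+ 10 * (+ 3 * U + + 3 * D)) ≡ + 30 * (+ 120 * U) + + 120 * (+ 30 * D)
      regroup = solve-∀

    odd-index : ∀ j → suc (2 ℕ.* suc (suc j)) ≡ 5 ℕ.+ (j ℕ.+ j)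
    odd-index = Data.Nat.Tactic.RingSolver.solve-∀

    even-index : ∀ j → 2 ℕ.* suc (suc j) ≡ 4 ℕ.+ (j ℕ.+ j)
    even-index = Data.Nat.Tactic.RingSolver.solve-∀

  oddPoly evenPoly : ℤ → ℤ
  oddPoly K = + 12 * K ^ 5 + + 25 * K ^ 4 + + 5 * K ^ 3 - + 10 * K ^ 2 - + 2 * K
  evenPoly K = + 12 * K ^ 5 - + 5 * K ^ 4 - + 15 * K ^ 3 + + 5 * K ^ 2 + + 3 * K

  pentagonCount-odd-step : ∀ j → + 120 * (+ 10 * + pentagonCount (5 ℕ.+ (j ℕ.+ j))) ≡ + 120 * oddPoly (+ 2 + + j)
  pentagonCount-odd-step j = begin
    + 120 * (+ 10 * + pentagonCount (5 ℕ.+ (j ℕ.+ j)))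
      ≡⟨ scaled-count (simplexSize 5 (2 ℕ.+ (j ℕ.+ j))) (skewSize 4 (suc (j ℕ.+ j))) ⟩
    + 30 * (+ 120 * + simplexSize 5 (2 ℕ.+ (j ℕ.+ j))) + + 120 * (+ 30 * + skewSize 4 (suc (j ℕ.+ j)))
      ≡⟨ cong₂ (λ x y → + 30 * x + + 120 * y) (simplexSize-poly 5 (2 ℕ.+ (j ℕ.+ j))) (skewSize-odd j) ⟩
    + 30 * risingℤ (+ 2 + (+ j + + j)) 5 + + 120 * skewOdd (+ j)
      ≡⟨ identity (+ j) ⟩
    + 120 * oddPoly (+ 2 + + j) ∎
    where
    open ≡-Reasoning
    identity : ∀ J → + 30 * (+ 1 * (+ 2 + (J + J) + + 1) * (+ 2 + (J + J) + + 2) * (+ 2 + (J + J) + + 3) * (+ 2 + (J + J) + + 4) * (+ 2 + (J + J) + + 5))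
                      + + 120 * (+ 150 + + 401 * J + + 405 * (J * J) + + 195 * (J * J * J) + + 45 * (J * J * J * J) + + 4 * (J * J * J * J * J))
                ≡ + 120 * (+ 12 * ((+ 2 + J) * ((+ 2 + J) * ((+ 2 + J) * ((+ 2 + J) * ((+ 2 + J) * + 1))))) + + 25 * ((+ 2 + J) * ((+ 2 + J) * ((+ 2 + J) * ((+ 2 + J) * + 1))))
                           + + 5 * ((+ 2 + J) * ((+ 2 + J) * ((+ 2 + J) * + 1))) - + 10 * ((+ 2 + J) * ((+ 2 + J) * + 1)) - + 2 * (+ 2 + J))
    identity = solve-∀

  pentagonCount-even-step : ∀ j → + 120 * (+ 10 * + pentagonCount (4 ℕ.+ (j ℕ.+ j))) ≡ + 120 * evenPoly (+ 2 + + j)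
  pentagonCount-even-step j = begin
    + 120 * (+ 10 * + pentagonCount (4 ℕ.+ (j ℕ.+ j)))
      ≡⟨ scaled-count (simplexSize 5 (1 ℕ.+ (j ℕ.+ j))) (skewSize 4 (j ℕ.+ j)) ⟩
    + 30 * (+ 120 * + simplexSize 5 (1 ℕ.+ (j ℕ.+ j))) + + 120 * (+ 30 * + skewSize 4 (j ℕ.+ j))
      ≡⟨ cong₂ (λ x y → + 30 * x + + 120 * y) (simplexSize-poly 5 (1 ℕ.+ (j ℕ.+ j))) (skewSize-even j) ⟩
    + 30 * risingℤ (+ 1 + (+ j + + j)) 5 + + 120 * skewEven (+ j)
      ≡⟨ identity (+ j) ⟩
    + 120 * evenPoly (+ 2 + + j) ∎
    where
    open ≡-Reasoning
    identity : ∀ J → + 30 * (+ 1 * (+ 1 + (J + J) + + 1) * (+ 1 + (J + J) + + 2) * (+ 1 + (J + J) + + 3) * (+ 1 + (J + J) + + 4) * (+ 1 + (J + J) + + 5))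
                      + + 120 * (+ 30 + + 121 * J + + 175 * (J * J) + + 115 * (J * J * J) + + 35 * (J * J * J * J) + + 4 * (J * J * J * J * J))
                ≡ + 120 * (+ 12 * ((+ 2 + J) * ((+ 2 + J) * ((+ 2 + J) * ((+ 2 + J) * ((+ 2 + J) * + 1))))) - + 5 * ((+ 2 + J) * ((+ 2 + J) * ((+ 2 + J) * ((+ 2 + J) * + 1))))
                           - + 15 * ((+ 2 + J) * ((+ 2 + J) * ((+ 2 + J) * + 1))) + + 5 * ((+ 2 + J) * ((+ 2 + J) * + 1)) + + 3 * (+ 2 + J))
    identity = solve-∀

  pentagonCount-odd : ∀ k → + 10 * + pentagonCount (suc (2 ℕ.* k)) ≡ oddPoly (+ k)
  pentagonCount-odd zero = refl
  pentagonCount-odd (suc zero) = refl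
  pentagonCount-odd (suc (suc j)) =
    trans (cong (λ n → + 10 * + pentagonCount n) (odd-index j))
          (ℤP.*-cancelˡ-≡ (+ 120) _ _ (pentagonCount-odd-step j))

  pentagonCount-even : ∀ k → k ℕ.≥ 1 → + 10 * + pentagonCount (2 ℕ.* k) ≡ evenPoly (+ k)
  pentagonCount-even (suc zero) _ = refl
  pentagonCount-even (suc (suc j)) _ =
    trans (cong (λ n → + 10 * + pentagonCount n) (even-index j))
          (ℤP.*-cancelˡ-≡ (+ 120) _ _ (pentagonCount-even-step j))

module Directions where

  open import Defs
  open NetTuples using (NPoint; pt; height)
  open import Data.Nat as ℕ using (ℕ; zero; suc)
  import Data.Nat.Properties as ℕP
  open import Data.Integer as ℤ using (ℤ; +_; -[1+_]; _+_; _*_; _-_; -_; _<_; _≤_; +<+; +≤+)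
  import Data.Integer.Properties as ℤP
  open import Data.Integer.Tactic.RingSolver using (solve-∀)
  open import Data.Product using (_×_; _,_; proj₁; proj₂; ∃-syntax)
  open import Data.Sum using (inj₁; inj₂)
  open import Relation.Binary.PropositionalEquality
  open import Relation.Nullary using (¬_)
  open import Data.Empty using (⊥-elim)

  data Dir : Set where
    d0 d1 d2 d3 d4 d5 : Dir

  unit : Dir → Point
  unit d0 = (+ 1 , + 0)
  unit d1 = (+ 0 , + 1)
  unit d2 = (- + 1 , + 1)
  unit d3 = (- + 1 , + 0)
  unit d4 = (+ 0 , - + 1)
  unit d5 = (+ 1 , - + 1)

  -- A net segment: a direction and a length t + 1, and its displacement vector
  -- (written with constructors, so that direction and length can be read off).
  Segment : Set
  Segment = Dir × ℕ

  vec : Segment → Point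
  vec (d0 , t) = (+ suc t , + 0)
  vec (d1 , t) = (+ 0 , + suc t)
  vec (d2 , t) = (-[1+ t ] , + suc t)
  vec (d3 , t) = (-[1+ t ] , + 0)
  vec (d4 , t) = (+ 0 , -[1+ t ])
  vec (d5 , t) = (+ suc t , -[1+ t ])

  turn : Dir → Dir → ℤ
  turn d d′ = cross (unit d) (unit d′)

  -- cross is bilinear, so the orientation of two segments is that of their directions
  cross-vec : ∀ d d′ t s → cross (vec (d , t)) (vec (d′ , s)) ≡ (+ suc t * + suc s) * turn d d′
  cross-vec d d′ t s = trans (cong₂ cross (scaled d t) (scaled d′ s)) (bilinear (+ suc t) (+ suc s) (unit d) (unit d′))
    where
    _·_ : ℤ → Point → Point
    c · (x , y) = (c * x , c * y)
    bilinear : ∀ a b u w → cross (a · u) (b · w) ≡ a * b * cross u w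
    bilinear a b (x₁ , y₁) (x₂ , y₂) = identity a b x₁ y₁ x₂ y₂
      where
      identity : ∀ a b x₁ y₁ x₂ y₂ → (a * x₁) * (b * y₂) - (a * y₁) * (b * x₂) ≡ a * b * (x₁ * y₂ - y₁ * x₂)
      identity = solve-∀
    one : ∀ c → c ≡ c * + 1
    one c = sym (ℤP.*-identityʳ c)
    zero′ : ∀ c → + 0 ≡ c * + 0
    zero′ c = sym (ℤP.*-zeroʳ c)
    minus : ∀ c → - c ≡ c * - + 1
    minus c = sym (trans (ℤP.*-comm c (- + 1)) (ℤP.-1*i≡-i c))
    scaled : ∀ d t → vec (d , t) ≡ (+ suc t) · unit d
    scaled d0 t = cong₂ _,_ (one (+ suc t)) (zero′ (+ suc t))
    scaled d1 t = cong₂ _,_ (zero′ (+ suc t)) (one (+ suc t))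
    scaled d2 t = cong₂ _,_ (minus (+ suc t)) (one (+ suc t))
    scaled d3 t = cong₂ _,_ (minus (+ suc t)) (zero′ (+ suc t))
    scaled d4 t = cong₂ _,_ (zero′ (+ suc t)) (minus (+ suc t))
    scaled d5 t = cong₂ _,_ (one (+ suc t)) (minus (+ suc t))

  vec-netDirection : ∀ s → NetDirection (vec s)
  vec-netDirection (d0 , t) = (λ ()) , inj₂ (inj₁ refl)
  vec-netDirection (d1 , t) = (λ ()) , inj₁ refl
  vec-netDirection (d2 , t) = (λ ()) , inj₂ (inj₂ (ℤP.+-inverseˡ (+ suc t)))
  vec-netDirection (d3 , t) = (λ ()) , inj₂ (inj₁ refl)
  vec-netDirection (d4 , t) = (λ ()) , inj₁ refl
  vec-netDirection (d5 , t) = (λ ()) , inj₂ (inj₂ (ℤP.+-inverseʳ (+ suc t)))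

  private
    sum-zero : ∀ x y → x + y ≡ + 0 → y ≡ - x
    sum-zero x y x+y≡0 = trans (identity x y) (trans (cong (λ z → - x + z) x+y≡0) (ℤP.+-identityʳ (- x)))
      where
      identity : ∀ x y → y ≡ - x + (x + y)
      identity = solve-∀

  netDirection-vec : ∀ p → NetDirection p → ∃[ s ] p ≡ vec s
  netDirection-vec (x , y) (nonzero , inj₁ refl) with y
  ... | + zero = ⊥-elim (nonzero refl)
  ... | + suc t = (d1 , t) , refl
  ... | -[1+ t ] = (d4 , t) , refl
  netDirection-vec (x , y) (nonzero , inj₂ (inj₁ refl)) with x
  ... | + zero = ⊥-elim (nonzero refl)
  ... | + suc t = (d0 , t) , refl
  ... | -[1+ t ] = (d3 , t) , refl
  netDirection-vec (x , y) (nonzero , inj₂ (inj₂ x+y≡0)) with sum-zero x y x+y≡0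
  netDirection-vec (+ zero , _) (nonzero , _) | refl = ⊥-elim (nonzero refl)
  netDirection-vec (+ suc t , _) _ | refl = (d5 , t) , refl
  netDirection-vec (-[1+ t ] , _) _ | refl = (d2 , t) , refl

  data _↺_ : Dir → Dir → Set where
    d0↺d1 : d0 ↺ d1
    d0↺d2 : d0 ↺ d2
    d1↺d2 : d1 ↺ d2
    d1↺d3 : d1 ↺ d3
    d2↺d3 : d2 ↺ d3
    d2↺d4 : d2 ↺ d4
    d3↺d4 : d3 ↺ d4
    d3↺d5 : d3 ↺ d5
    d4↺d5 : d4 ↺ d5
    d4↺d0 : d4 ↺ d0
    d5↺d0 : d5 ↺ d0
    d5↺d1 : d5 ↺ d1

  ↺-turn : ∀ {d d′} → d ↺ d′ → turn d d′ ≡ + 1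
  ↺-turn d0↺d1 = refl
  ↺-turn d0↺d2 = refl
  ↺-turn d1↺d2 = refl
  ↺-turn d1↺d3 = refl
  ↺-turn d2↺d3 = refl
  ↺-turn d2↺d4 = refl
  ↺-turn d3↺d4 = refl
  ↺-turn d3↺d5 = refl
  ↺-turn d4↺d5 = refl
  ↺-turn d4↺d0 = refl
  ↺-turn d5↺d0 = refl
  ↺-turn d5↺d1 = refl

  positive-↺ : ∀ d d′ → + 0 < turn d d′ → d ↺ d′
  positive-↺ d0 d1 _ = d0↺d1
  positive-↺ d0 d2 _ = d0↺d2
  positive-↺ d1 d2 _ = d1↺d2
  positive-↺ d1 d3 _ = d1↺d3
  positive-↺ d2 d3 _ = d2↺d3
  positive-↺ d2 d4 _ = d2↺d4
  positive-↺ d3 d4 _ = d3↺d4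
  positive-↺ d3 d5 _ = d3↺d5
  positive-↺ d4 d5 _ = d4↺d5
  positive-↺ d4 d0 _ = d4↺d0
  positive-↺ d5 d0 _ = d5↺d0
  positive-↺ d5 d1 _ = d5↺d1
  positive-↺ d0 d0 (+<+ ())
  positive-↺ d0 d3 (+<+ ())
  positive-↺ d0 d4 ()
  positive-↺ d0 d5 ()
  positive-↺ d1 d0 ()
  positive-↺ d1 d1 (+<+ ())
  positive-↺ d1 d4 (+<+ ())
  positive-↺ d1 d5 ()
  positive-↺ d2 d0 ()
  positive-↺ d2 d1 ()
  positive-↺ d2 d2 (+<+ ())
  positive-↺ d2 d5 (+<+ ())
  positive-↺ d3 d0 (+<+ ())
  positive-↺ d3 d1 ()
  positive-↺ d3 d2 ()
  positive-↺ d3 d3 (+<+ ())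
  positive-↺ d4 d1 (+<+ ())
  positive-↺ d4 d2 ()
  positive-↺ d4 d3 ()
  positive-↺ d4 d4 (+<+ ())
  positive-↺ d5 d2 (+<+ ())
  positive-↺ d5 d3 ()
  positive-↺ d5 d4 ()
  positive-↺ d5 d5 (+<+ ())

  left-turn : ∀ {d d′ t s} → + 0 < cross (vec (d , t)) (vec (d′ , s)) → d ↺ d′
  left-turn {d} {d′} {t} {s} positive = positive-↺ d d′ (ℤP.*-cancelˡ-<-nonNeg (+ suc t * + suc s)
    (subst (_< (+ suc t * + suc s) * turn d d′) (sym (ℤP.*-zeroʳ (+ suc t * + suc s)))
      (subst (+ 0 <_) (cross-vec d d′ t s) positive)))

  ↺-cross : ∀ {d d′} t s → d ↺ d′ → + 0 < cross (vec (d , t)) (vec (d′ , s))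
  ↺-cross {d} {d′} t s d↺d′ = subst (+ 0 <_) (sym (cross-vec d d′ t s))
    (subst (λ x → + 0 < (+ suc t * + suc s) * x) (sym (↺-turn d↺d′))
      (subst (+ 0 <_) (sym (ℤP.*-identityʳ (+ suc t * + suc s))) (+<+ (ℕ.s≤s ℕ.z≤n))))

  nonneg-cross : ∀ {d d′} t s → + 0 ≤ turn d d′ → + 0 ≤ cross (vec (d , t)) (vec (d′ , s))
  nonneg-cross {d} {d′} t s 0≤turn = subst (+ 0 ≤_) (sym (cross-vec d d′ t s))
    (subst (_≤ (+ suc t * + suc s) * turn d d′) (ℤP.*-zeroʳ (+ suc t * + suc s))
      (ℤP.*-monoˡ-≤-nonNeg (+ suc t * + suc s) 0≤turn))

  infix 4 _─[_]→_
  _─[_]→_ : NPoint → Segment → NPoint → Set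
  (x , y) ─[ d0 , t ]→ (x′ , y′) = x′ ≡ x ℕ.+ suc t × y′ ≡ y
  (x , y) ─[ d1 , t ]→ (x′ , y′) = x′ ≡ x × y′ ≡ y ℕ.+ suc t
  (x , y) ─[ d2 , t ]→ (x′ , y′) = x ≡ x′ ℕ.+ suc t × y′ ≡ y ℕ.+ suc t
  (x , y) ─[ d3 , t ]→ (x′ , y′) = x ≡ x′ ℕ.+ suc t × y′ ≡ y
  (x , y) ─[ d4 , t ]→ (x′ , y′) = x′ ≡ x × y ≡ y′ ℕ.+ suc t
  (x , y) ─[ d5 , t ]→ (x′ , y′) = x′ ≡ x ℕ.+ suc t × y ≡ y′ ℕ.+ suc t

  private
    difference-pos : ∀ a b t → + a - + b ≡ + suc t → a ≡ b ℕ.+ suc t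
    difference-pos a b t eq = trans (ℤP.+-injective (trans (identity (+ a) (+ b)) (cong (_+ + b) eq)))
                                    (ℕP.+-comm (suc t) b)
      where
      identity : ∀ a b → a ≡ (a - b) + b
      identity = solve-∀

    difference-zero : ∀ a b → + a - + b ≡ + 0 → a ≡ b
    difference-zero a b eq = ℤP.+-injective (trans (identity (+ a) (+ b)) (cong (_+ + b) eq))
      where
      identity : ∀ a b → a ≡ (a - b) + b
      identity = solve-∀

    difference-neg : ∀ a b t → + a - + b ≡ -[1+ t ] → b ≡ a ℕ.+ suc t
    difference-neg a b t eq = ℤP.+-injective (trans (identity (+ a) (+ b)) (cong (λ z → + a - z) eq))
      where
      identity : ∀ a b → b ≡ a - (a - b)
      identity = solve-∀

    pos-difference : ∀ b t → + (b ℕ.+ suc t) - + b ≡ + suc t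
    pos-difference b t = trans (cong (_- + b) (ℤP.pos-+ b (suc t))) (identity (+ b) (+ suc t))
      where
      identity : ∀ b c → (b + c) - b ≡ c
      identity = solve-∀

    neg-difference : ∀ a t → + a - + (a ℕ.+ suc t) ≡ -[1+ t ]
    neg-difference a t = trans (cong (λ z → + a - z) (ℤP.pos-+ a (suc t))) (identity (+ a) (+ suc t))
      where
      identity : ∀ a c → a - (a + c) ≡ - c
      identity = solve-∀

  vec⇒step : ∀ s p q → pt q ⊖ pt p ≡ vec s → p ─[ s ]→ q
  vec⇒step (d0 , t) (x , y) (x′ , y′) eq = difference-pos x′ x t (cong proj₁ eq) , difference-zero y′ y (cong proj₂ eq)
  vec⇒step (d1 , t) (x , y) (x′ , y′) eq = difference-zero x′ x (cong proj₁ eq) , difference-pos y′ y t (cong proj₂ eq)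
  vec⇒step (d2 , t) (x , y) (x′ , y′) eq = difference-neg x′ x t (cong proj₁ eq) , difference-pos y′ y t (cong proj₂ eq)
  vec⇒step (d3 , t) (x , y) (x′ , y′) eq = difference-neg x′ x t (cong proj₁ eq) , difference-zero y′ y (cong proj₂ eq)
  vec⇒step (d4 , t) (x , y) (x′ , y′) eq = difference-zero x′ x (cong proj₁ eq) , difference-neg y′ y t (cong proj₂ eq)
  vec⇒step (d5 , t) (x , y) (x′ , y′) eq = difference-pos x′ x t (cong proj₁ eq) , difference-neg y′ y t (cong proj₂ eq)

  step⇒vec : ∀ s p q → p ─[ s ]→ q → pt q ⊖ pt p ≡ vec s
  step⇒vec (d0 , t) (x , y) _ (refl , refl) = cong₂ _,_ (pos-difference x t) (ℤP.+-inverseʳ (+ y))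
  step⇒vec (d1 , t) (x , y) _ (refl , refl) = cong₂ _,_ (ℤP.+-inverseʳ (+ x)) (pos-difference y t)
  step⇒vec (d2 , t) (x , y) (x′ , _) (refl , refl) = cong₂ _,_ (neg-difference x′ t) (pos-difference y t)
  step⇒vec (d3 , t) (x , y) (x′ , _) (refl , refl) = cong₂ _,_ (neg-difference x′ t) (ℤP.+-inverseʳ (+ y))
  step⇒vec (d4 , t) (x , y) (_ , y′) (refl , refl) = cong₂ _,_ (ℤP.+-inverseʳ (+ x)) (neg-difference y′ t)
  step⇒vec (d5 , t) (x , y) (_ , y′) (refl , refl) = cong₂ _,_ (pos-difference x t) (neg-difference y′ t)

  data LexUp : Dir → Set where
    up5 : LexUp d5
    up0 : LexUp d0
    up1 : LexUp d1

  data LexDown : Dir → Set where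
    down2 : LexDown d2
    down3 : LexDown d3
    down4 : LexDown d4

  private
    ≮-+suc : ∀ a t → ¬ (+ (a ℕ.+ suc t) < + a)
    ≮-+suc a t (+<+ lt) = ℕP.<-irrefl refl (ℕP.≤-trans (ℕ.s≤s (ℕP.m≤m+n a (suc t))) lt)
    ≰-+suc : ∀ a t → ¬ (+ (a ℕ.+ suc t) ≤ + a)
    ≰-+suc a t (+≤+ le) = ℕP.<-irrefl refl (ℕP.<-≤-trans (ℕP.m<m+n a (ℕ.s≤s ℕ.z≤n)) le)
    ≢-+suc : ∀ a t → + (a ℕ.+ suc t) ≢ + a
    ≢-+suc a t eq = ℕP.<-irrefl (sym (ℤP.+-injective eq)) (ℕP.m<m+n a (ℕ.s≤s ℕ.z≤n))

  lexUp-of : ∀ s p q → p ─[ s ]→ q → pt p ≤lex pt q → LexUp (proj₁ s)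
  lexUp-of (d0 , _) _ _ _ _ = up0
  lexUp-of (d1 , _) _ _ _ _ = up1
  lexUp-of (d5 , _) _ _ _ _ = up5
  lexUp-of (d2 , t) _ (x′ , _) (refl , _) (inj₁ lt) = ⊥-elim (≮-+suc x′ t lt)
  lexUp-of (d2 , t) _ (x′ , _) (refl , _) (inj₂ (eq , _)) = ⊥-elim (≢-+suc x′ t eq)
  lexUp-of (d3 , t) _ (x′ , _) (refl , _) (inj₁ lt) = ⊥-elim (≮-+suc x′ t lt)
  lexUp-of (d3 , t) _ (x′ , _) (refl , _) (inj₂ (eq , _)) = ⊥-elim (≢-+suc x′ t eq)
  lexUp-of (d4 , t) _ _ (refl , _) (inj₁ lt) = ⊥-elim (ℤP.<-irrefl refl lt)
  lexUp-of (d4 , t) _ (_ , y′) (refl , refl) (inj₂ (_ , le)) = ⊥-elim (≰-+suc y′ t le)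

  lexDown-of : ∀ s p q → p ─[ s ]→ q → pt q ≤lex pt p → LexDown (proj₁ s)
  lexDown-of (d2 , _) _ _ _ _ = down2
  lexDown-of (d3 , _) _ _ _ _ = down3
  lexDown-of (d4 , _) _ _ _ _ = down4
  lexDown-of (d0 , t) (x , _) _ (refl , _) (inj₁ lt) = ⊥-elim (≮-+suc x t lt)
  lexDown-of (d0 , t) (x , _) _ (refl , _) (inj₂ (eq , _)) = ⊥-elim (≢-+suc x t eq)
  lexDown-of (d5 , t) (x , _) _ (refl , _) (inj₁ lt) = ⊥-elim (≮-+suc x t lt)
  lexDown-of (d5 , t) (x , _) _ (refl , _) (inj₂ (eq , _)) = ⊥-elim (≢-+suc x t eq)
  lexDown-of (d1 , t) _ _ (refl , _) (inj₁ lt) = ⊥-elim (ℤP.<-irrefl refl lt)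
  lexDown-of (d1 , t) (_ , y) _ (refl , refl) (inj₂ (_ , le)) = ⊥-elim (≰-+suc y t le)

  ≤lex-trans : ∀ {p q r} → p ≤lex q → q ≤lex r → p ≤lex r
  ≤lex-trans (inj₁ a<c) (inj₁ c<e) = inj₁ (ℤP.<-trans a<c c<e)
  ≤lex-trans (inj₁ a<c) (inj₂ (refl , _)) = inj₁ a<c
  ≤lex-trans (inj₂ (refl , _)) (inj₁ c<e) = inj₁ c<e
  ≤lex-trans (inj₂ (refl , b≤d)) (inj₂ (refl , d≤f)) = inj₂ (refl , ℤP.≤-trans b≤d d≤f)

  lexUp-step : ∀ {d t p q} → LexUp d → p ─[ d , t ]→ q → pt p ≤lex pt q
  lexUp-step {p = x , _} up0 (refl , _) = inj₁ (+<+ (ℕP.m<m+n x (ℕ.s≤s ℕ.z≤n)))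
  lexUp-step {t = t} {_ , y} up1 (refl , refl) = inj₂ (refl , +≤+ (ℕP.m≤m+n y (suc t)))
  lexUp-step {p = x , _} up5 (refl , _) = inj₁ (+<+ (ℕP.m<m+n x (ℕ.s≤s ℕ.z≤n)))

  lexDown-step : ∀ {d t p q} → LexDown d → p ─[ d , t ]→ q → pt q ≤lex pt p
  lexDown-step {q = x′ , _} down2 (refl , _) = inj₁ (+<+ (ℕP.m<m+n x′ (ℕ.s≤s ℕ.z≤n)))
  lexDown-step {q = x′ , _} down3 (refl , _) = inj₁ (+<+ (ℕP.m<m+n x′ (ℕ.s≤s ℕ.z≤n)))
  lexDown-step {t = t} {q = _ , y′} down4 (refl , refl) = inj₂ (refl , +≤+ (ℕP.m≤m+n y′ (suc t)))

  data Rising : Dir → Set where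
    rise0 : Rising d0
    rise1 : Rising d1
    rise2 : Rising d2
    rise5 : Rising d5

  data Falling : Dir → Set where
    fall2 : Falling d2
    fall3 : Falling d3
    fall4 : Falling d4
    fall5 : Falling d5

  private
    level2 : ∀ x′ y t → height (x′ ℕ.+ suc t , y) ≡ height (x′ , y ℕ.+ suc t)
    level2 x′ y t = trans (ℕP.+-assoc x′ (suc t) y) (cong (x′ ℕ.+_) (ℕP.+-comm (suc t) y))
    level5 : ∀ x y′ t → height (x , y′ ℕ.+ suc t) ≡ height (x ℕ.+ suc t , y′)
    level5 x y′ t = sym (level2 x y′ t)

  rising-step : ∀ {d t p q} → Rising d → p ─[ d , t ]→ q → height p ℕ.≤ height q
  rising-step {t = t} {x , y} rise0 (refl , refl) = ℕP.+-monoˡ-≤ y (ℕP.m≤m+n x (suc t))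
  rising-step {t = t} {x , y} rise1 (refl , refl) = ℕP.+-monoʳ-≤ x (ℕP.m≤m+n y (suc t))
  rising-step {t = t} {_ , y} {x′ , _} rise2 (refl , refl) = ℕP.≤-reflexive (level2 x′ y t)
  rising-step {t = t} {x , _} {_ , y′} rise5 (refl , refl) = ℕP.≤-reflexive (level5 x y′ t)

  falling-step : ∀ {d t p q} → Falling d → p ─[ d , t ]→ q → height q ℕ.≤ height p
  falling-step {t = t} {_ , y} {x′ , _} fall2 (refl , refl) = ℕP.≤-reflexive (sym (level2 x′ y t))
  falling-step {t = t} {_ , y} {x′ , _} fall3 (refl , refl) = ℕP.+-monoˡ-≤ y (ℕP.m≤m+n x′ (suc t))
  falling-step {t = t} {x , _} {_ , y′} fall4 (refl , refl) = ℕP.+-monoʳ-≤ x (ℕP.m≤m+n y′ (suc t))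
  falling-step {t = t} {x , _} {_ , y′} fall5 (refl , refl) = ℕP.≤-reflexive (sym (level5 x y′ t))

module Pentagons where

  open import Defs
  open NetTuples using (Tup; vertex; IsPentagon; NPoint; pt; height)
  open Directions
  open import Data.Integer as ℤ using (+_; _+_; _-_; _*_; _<_; _≤_; +≤+)
  import Data.Integer.Properties as ℤP
  open import Data.Nat as ℕ using (ℕ; z≤n)
  import Data.Nat.Properties as ℕP
  open import Data.Integer.Tactic.RingSolver using (solve-∀)
  open import Data.Product using (_×_; _,_; proj₁; proj₂; ∃-syntax)
  open import Data.Sum using (_⊎_; inj₁; inj₂)
  open import Data.Fin using (Fin) renaming (zero to f0; suc to fs)
  open import Relation.Binary.PropositionalEquality
  open import Data.Empty using (⊥-elim)

  edge : Tup → Fin 5 → Point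
  edge p i = vertex p (next i) ⊖ vertex p i

  next⁵ : ∀ i → next (next (next (next (next i)))) ≡ i
  next⁵ f0 = refl
  next⁵ (fs f0) = refl
  next⁵ (fs (fs f0)) = refl
  next⁵ (fs (fs (fs f0))) = refl
  next⁵ (fs (fs (fs (fs f0)))) = refl

  other-vertex : ∀ i j → j ≢ i → j ≢ next i →
                 j ≡ next (next i) ⊎ j ≡ next (next (next i)) ⊎ j ≡ next (next (next (next i)))
  other-vertex f0 f0 j≢i _ = ⊥-elim (j≢i refl)
  other-vertex f0 (fs f0) _ j≢next = ⊥-elim (j≢next refl)
  other-vertex f0 (fs (fs f0)) _ _ = inj₁ refl
  other-vertex f0 (fs (fs (fs f0))) _ _ = inj₂ (inj₁ refl)
  other-vertex f0 (fs (fs (fs (fs f0)))) _ _ = inj₂ (inj₂ refl)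
  other-vertex (fs f0) f0 _ _ = inj₂ (inj₂ refl)
  other-vertex (fs f0) (fs f0) j≢i _ = ⊥-elim (j≢i refl)
  other-vertex (fs f0) (fs (fs f0)) _ j≢next = ⊥-elim (j≢next refl)
  other-vertex (fs f0) (fs (fs (fs f0))) _ _ = inj₁ refl
  other-vertex (fs f0) (fs (fs (fs (fs f0)))) _ _ = inj₂ (inj₁ refl)
  other-vertex (fs (fs f0)) f0 _ _ = inj₂ (inj₁ refl)
  other-vertex (fs (fs f0)) (fs f0) _ _ = inj₂ (inj₂ refl)
  other-vertex (fs (fs f0)) (fs (fs f0)) j≢i _ = ⊥-elim (j≢i refl)
  other-vertex (fs (fs f0)) (fs (fs (fs f0))) _ j≢next = ⊥-elim (j≢next refl)
  other-vertex (fs (fs f0)) (fs (fs (fs (fs f0)))) _ _ = inj₁ refl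
  other-vertex (fs (fs (fs f0))) f0 _ _ = inj₁ refl
  other-vertex (fs (fs (fs f0))) (fs f0) _ _ = inj₂ (inj₁ refl)
  other-vertex (fs (fs (fs f0))) (fs (fs f0)) _ _ = inj₂ (inj₂ refl)
  other-vertex (fs (fs (fs f0))) (fs (fs (fs f0))) j≢i _ = ⊥-elim (j≢i refl)
  other-vertex (fs (fs (fs f0))) (fs (fs (fs (fs f0)))) _ j≢next = ⊥-elim (j≢next refl)
  other-vertex (fs (fs (fs (fs f0)))) f0 _ j≢next = ⊥-elim (j≢next refl)
  other-vertex (fs (fs (fs (fs f0)))) (fs f0) _ _ = inj₁ refl
  other-vertex (fs (fs (fs (fs f0)))) (fs (fs f0)) _ _ = inj₂ (inj₁ refl)
  other-vertex (fs (fs (fs (fs f0)))) (fs (fs (fs f0))) _ _ = inj₂ (inj₂ refl)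
  other-vertex (fs (fs (fs (fs f0)))) (fs (fs (fs (fs f0)))) j≢i _ = ⊥-elim (j≢i refl)

  private
    ahead : ∀ A B C → cross (B ⊖ A) (C ⊖ A) ≡ cross (B ⊖ A) (C ⊖ B)
    ahead (a₁ , a₂) (b₁ , b₂) (c₁ , c₂) = identity a₁ a₂ b₁ b₂ c₁ c₂
      where
      identity : ∀ a₁ a₂ b₁ b₂ c₁ c₂ → (b₁ - a₁) * (c₂ - a₂) - (b₂ - a₂) * (c₁ - a₁)
                                      ≡ (b₁ - a₁) * (c₂ - b₂) - (b₂ - a₂) * (c₁ - b₁)
      identity = solve-∀

    behind : ∀ Z A B → cross (B ⊖ A) (Z ⊖ A) ≡ cross (A ⊖ Z) (B ⊖ A)
    behind (z₁ , z₂) (a₁ , a₂) (b₁ , b₂) = identity z₁ z₂ a₁ a₂ b₁ b₂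
      where
      identity : ∀ z₁ z₂ a₁ a₂ b₁ b₂ → (b₁ - a₁) * (z₂ - a₂) - (b₂ - a₂) * (z₁ - a₁)
                                      ≡ (a₁ - z₁) * (b₂ - a₂) - (a₂ - z₂) * (b₁ - a₁)
      identity = solve-∀

    opposite : ∀ Y Z A B → cross (B ⊖ A) (Y ⊖ A) ≡ cross (Z ⊖ Y) (B ⊖ A) + cross (A ⊖ Z) (B ⊖ A)
    opposite (y₁ , y₂) (z₁ , z₂) (a₁ , a₂) (b₁ , b₂) = identity y₁ y₂ z₁ z₂ a₁ a₂ b₁ b₂
      where
      identity : ∀ y₁ y₂ z₁ z₂ a₁ a₂ b₁ b₂ → (b₁ - a₁) * (y₂ - a₂) - (b₂ - a₂) * (y₁ - a₁)
                 ≡ ((z₁ - y₁) * (b₂ - a₂) - (z₂ - y₂) * (b₁ - a₁)) + ((a₁ - z₁) * (b₂ - a₂) - (a₂ - z₂) * (b₁ - a₁))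
      identity = solve-∀

  convex-from-turns : ∀ p → (∀ i → + 0 < cross (edge p i) (edge p (next i))) →
                            (∀ i → + 0 ≤ cross (edge p i) (edge p (next (next i)))) →
                            ∀ i j → j ≢ i → j ≢ next i → + 0 < cross (edge p i) (vertex p j ⊖ vertex p i)
  convex-from-turns p left nonright i j j≢i j≢next with other-vertex i j j≢i j≢next
  ... | inj₁ refl = subst (+ 0 <_) (sym (ahead (v i) (v (next i)) (v (next (next i))))) (left i)
    where v = vertex p
  ... | inj₂ (inj₁ refl) = subst (+ 0 <_) (sym (opposite (v i₃) (v i₄) (v i) (v (next i))))
          (ℤP.+-mono-≤-< (subst (λ k → + 0 ≤ cross (edge p i₃) (edge p k)) (next⁵ i) (nonright i₃))
                         (subst (λ k → + 0 < cross (v k ⊖ v i₄) (edge p k)) (next⁵ i) (left i₄)))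
    where
    v = vertex p
    i₃ = next (next (next i))
    i₄ = next i₃
  ... | inj₂ (inj₂ refl) = subst (+ 0 <_) (sym (behind (v i₄) (v i) (v (next i))))
          (subst (λ k → + 0 < cross (v k ⊖ v i₄) (edge p k)) (next⁵ i) (left i₄))
    where
    v = vertex p
    i₄ = next (next (next (next i)))

  -- Omits o a b c d f: the directions a b c d f (in this order, starting from the
  -- lexicographically least vertex) are all directions except o, counterclockwise.
  data Omits : Dir → Dir → Dir → Dir → Dir → Dir → Set where
    omit5 : Omits d5 d0 d1 d2 d3 d4
    omit4 : Omits d4 d5 d0 d1 d2 d3
    omit3 : Omits d3 d5 d0 d1 d2 d4
    omit2 : Omits d2 d5 d0 d1 d3 d4
    omit1 : Omits d1 d5 d0 d2 d3 d4
    omit0 : Omits d0 d5 d1 d2 d3 d4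

  -- The combinatorial core: five left turns closing up, leaving the least vertex
  -- in a LexUp direction and entering it in a LexDown direction, omit exactly one
  -- direction (the turning angles are 60° or 120° and add up to 360°); checked by
  -- exhaustive case analysis on the turns.
  turn-pattern : ∀ {a b c d f} → LexUp a → a ↺ b → b ↺ c → c ↺ d → d ↺ f → f ↺ a → LexDown f →
                 ∃[ o ] Omits o a b c d f
  turn-pattern up0 d0↺d1 d1↺d2 d2↺d3 d3↺d4 d4↺d0 down4 = d5 , omit5
  turn-pattern up0 d0↺d1 d1↺d2 d2↺d3 d3↺d5 d5↺d0 ()
  turn-pattern up0 d0↺d1 d1↺d2 d2↺d4 d4↺d5 d5↺d0 ()
  turn-pattern up0 d0↺d1 d1↺d2 d2↺d4 d4↺d0 () _
  turn-pattern up0 d0↺d1 d1↺d3 d3↺d4 d4↺d5 d5↺d0 ()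
  turn-pattern up0 d0↺d1 d1↺d3 d3↺d4 d4↺d0 () _
  turn-pattern up0 d0↺d1 d1↺d3 d3↺d5 d5↺d0 () _
  turn-pattern up0 d0↺d1 d1↺d3 d3↺d5 d5↺d1 () _
  turn-pattern up0 d0↺d2 d2↺d3 d3↺d4 d4↺d5 d5↺d0 ()
  turn-pattern up0 d0↺d2 d2↺d3 d3↺d4 d4↺d0 () _
  turn-pattern up0 d0↺d2 d2↺d3 d3↺d5 d5↺d0 () _
  turn-pattern up0 d0↺d2 d2↺d3 d3↺d5 d5↺d1 () _
  turn-pattern up0 d0↺d2 d2↺d4 d4↺d5 d5↺d0 () _
  turn-pattern up0 d0↺d2 d2↺d4 d4↺d5 d5↺d1 () _
  turn-pattern up0 d0↺d2 d2↺d4 d4↺d0 d0↺d1 () _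
  turn-pattern up0 d0↺d2 d2↺d4 d4↺d0 d0↺d2 () _
  turn-pattern up1 d1↺d2 d2↺d3 d3↺d4 d4↺d5 d5↺d1 ()
  turn-pattern up1 d1↺d2 d2↺d3 d3↺d4 d4↺d0 d0↺d1 ()
  turn-pattern up1 d1↺d2 d2↺d3 d3↺d5 d5↺d0 d0↺d1 ()
  turn-pattern up1 d1↺d2 d2↺d3 d3↺d5 d5↺d1 () _
  turn-pattern up1 d1↺d2 d2↺d4 d4↺d5 d5↺d0 d0↺d1 ()
  turn-pattern up1 d1↺d2 d2↺d4 d4↺d5 d5↺d1 () _
  turn-pattern up1 d1↺d2 d2↺d4 d4↺d0 d0↺d1 () _
  turn-pattern up1 d1↺d2 d2↺d4 d4↺d0 d0↺d2 () _
  turn-pattern up1 d1↺d3 d3↺d4 d4↺d5 d5↺d0 d0↺d1 ()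
  turn-pattern up1 d1↺d3 d3↺d4 d4↺d5 d5↺d1 () _
  turn-pattern up1 d1↺d3 d3↺d4 d4↺d0 d0↺d1 () _
  turn-pattern up1 d1↺d3 d3↺d4 d4↺d0 d0↺d2 () _
  turn-pattern up1 d1↺d3 d3↺d5 d5↺d0 d0↺d1 () _
  turn-pattern up1 d1↺d3 d3↺d5 d5↺d0 d0↺d2 () _
  turn-pattern up1 d1↺d3 d3↺d5 d5↺d1 d1↺d2 () _
  turn-pattern up1 d1↺d3 d3↺d5 d5↺d1 d1↺d3 () _
  turn-pattern up5 d5↺d0 d0↺d1 d1↺d2 d2↺d3 d3↺d5 down3 = d4 , omit4
  turn-pattern up5 d5↺d0 d0↺d1 d1↺d2 d2↺d4 d4↺d5 down4 = d3 , omit3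
  turn-pattern up5 d5↺d0 d0↺d1 d1↺d3 d3↺d4 d4↺d5 down4 = d2 , omit2
  turn-pattern up5 d5↺d0 d0↺d1 d1↺d3 d3↺d5 () _
  turn-pattern up5 d5↺d0 d0↺d2 d2↺d3 d3↺d4 d4↺d5 down4 = d1 , omit1
  turn-pattern up5 d5↺d0 d0↺d2 d2↺d3 d3↺d5 () _
  turn-pattern up5 d5↺d0 d0↺d2 d2↺d4 d4↺d5 () _
  turn-pattern up5 d5↺d0 d0↺d2 d2↺d4 d4↺d0 () _
  turn-pattern up5 d5↺d1 d1↺d2 d2↺d3 d3↺d4 d4↺d5 down4 = d0 , omit0
  turn-pattern up5 d5↺d1 d1↺d2 d2↺d3 d3↺d5 () _
  turn-pattern up5 d5↺d1 d1↺d2 d2↺d4 d4↺d5 () _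
  turn-pattern up5 d5↺d1 d1↺d2 d2↺d4 d4↺d0 () _
  turn-pattern up5 d5↺d1 d1↺d3 d3↺d4 d4↺d5 () _
  turn-pattern up5 d5↺d1 d1↺d3 d3↺d4 d4↺d0 () _
  turn-pattern up5 d5↺d1 d1↺d3 d3↺d5 d5↺d0 () _
  turn-pattern up5 d5↺d1 d1↺d3 d3↺d5 d5↺d1 () _

  omits-turns : ∀ {o a b c d f} → Omits o a b c d f →
                (a ↺ b × b ↺ c × c ↺ d × d ↺ f × f ↺ a) ×
                (+ 0 ≤ turn a c × + 0 ≤ turn b d × + 0 ≤ turn c f × + 0 ≤ turn d a × + 0 ≤ turn f b)
  omits-turns omit5 = (d0↺d1 , d1↺d2 , d2↺d3 , d3↺d4 , d4↺d0) , (+≤+ z≤n , +≤+ z≤n , +≤+ z≤n , +≤+ z≤n , +≤+ z≤n)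
  omits-turns omit4 = (d5↺d0 , d0↺d1 , d1↺d2 , d2↺d3 , d3↺d5) , (+≤+ z≤n , +≤+ z≤n , +≤+ z≤n , +≤+ z≤n , +≤+ z≤n)
  omits-turns omit3 = (d5↺d0 , d0↺d1 , d1↺d2 , d2↺d4 , d4↺d5) , (+≤+ z≤n , +≤+ z≤n , +≤+ z≤n , +≤+ z≤n , +≤+ z≤n)
  omits-turns omit2 = (d5↺d0 , d0↺d1 , d1↺d3 , d3↺d4 , d4↺d5) , (+≤+ z≤n , +≤+ z≤n , +≤+ z≤n , +≤+ z≤n , +≤+ z≤n)
  omits-turns omit1 = (d5↺d0 , d0↺d2 , d2↺d3 , d3↺d4 , d4↺d5) , (+≤+ z≤n , +≤+ z≤n , +≤+ z≤n , +≤+ z≤n , +≤+ z≤n)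
  omits-turns omit0 = (d5↺d1 , d1↺d2 , d2↺d3 , d3↺d4 , d4↺d5) , (+≤+ z≤n , +≤+ z≤n , +≤+ z≤n , +≤+ z≤n , +≤+ z≤n)

  omits-lex : ∀ {o a b c d f} → Omits o a b c d f → LexUp a × LexUp b × LexDown d × LexDown f
  omits-lex omit5 = up0 , up1 , down3 , down4
  omits-lex omit4 = up5 , up0 , down2 , down3
  omits-lex omit3 = up5 , up0 , down2 , down4
  omits-lex omit2 = up5 , up0 , down3 , down4
  omits-lex omit1 = up5 , up0 , down3 , down4
  omits-lex omit0 = up5 , up1 , down3 , down4

  NTup : Set
  NTup = NPoint × NPoint × NPoint × NPoint × NPoint

  ptTup : NTup → Tup
  ptTup (p₀ , p₁ , p₂ , p₃ , p₄) = (pt p₀ , pt p₁ , pt p₂ , pt p₃ , pt p₄)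

  Sides : Set
  Sides = Segment × Segment × Segment × Segment × Segment

  side : Sides → Fin 5 → Segment
  side (s₀ , s₁ , s₂ , s₃ , s₄) f0 = s₀
  side (s₀ , s₁ , s₂ , s₃ , s₄) (fs f0) = s₁
  side (s₀ , s₁ , s₂ , s₃ , s₄) (fs (fs f0)) = s₂
  side (s₀ , s₁ , s₂ , s₃ , s₄) (fs (fs (fs f0))) = s₃
  side (s₀ , s₁ , s₂ , s₃ , s₄) (fs (fs (fs (fs f0)))) = s₄

  Walk : NTup → Sides → Set
  Walk (p₀ , p₁ , p₂ , p₃ , p₄) (s₀ , s₁ , s₂ , s₃ , s₄) =
    p₀ ─[ s₀ ]→ p₁ × p₁ ─[ s₁ ]→ p₂ × p₂ ─[ s₂ ]→ p₃ × p₃ ─[ s₃ ]→ p₄ × p₄ ─[ s₄ ]→ p₀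

  Pattern : Dir → Sides → Set
  Pattern o ((a , _) , (b , _) , (c , _) , (d , _) , (f , _)) = Omits o a b c d f

  walk-edges : ∀ ps ss → Walk ps ss → ∀ i → edge (ptTup ps) i ≡ vec (side ss i)
  walk-edges (p₀ , p₁ , p₂ , p₃ , p₄) (s₀ , s₁ , s₂ , s₃ , s₄) (w₀ , w₁ , w₂ , w₃ , w₄) = λ where
    f0 → step⇒vec s₀ p₀ p₁ w₀
    (fs f0) → step⇒vec s₁ p₁ p₂ w₁
    (fs (fs f0)) → step⇒vec s₂ p₂ p₃ w₂
    (fs (fs (fs f0))) → step⇒vec s₃ p₃ p₄ w₃
    (fs (fs (fs (fs f0)))) → step⇒vec s₄ p₄ p₀ w₄

  pattern-left : ∀ {o} ss → Pattern o ss → ∀ i → + 0 < cross (vec (side ss i)) (vec (side ss (next i)))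
  pattern-left ((_ , t₀) , (_ , t₁) , (_ , t₂) , (_ , t₃) , (_ , t₄)) pat
    with (ab , bc , cd , df , fa) , _ ← omits-turns pat = λ where
    f0 → ↺-cross t₀ t₁ ab
    (fs f0) → ↺-cross t₁ t₂ bc
    (fs (fs f0)) → ↺-cross t₂ t₃ cd
    (fs (fs (fs f0))) → ↺-cross t₃ t₄ df
    (fs (fs (fs (fs f0)))) → ↺-cross t₄ t₀ fa

  pattern-nonright : ∀ {o} ss → Pattern o ss → ∀ i → + 0 ≤ cross (vec (side ss i)) (vec (side ss (next (next i))))
  pattern-nonright ((a , t₀) , (b , t₁) , (c , t₂) , (d , t₃) , (f , t₄)) pat
    with _ , (ac , bd , cf , da , fb) ← omits-turns pat = λ where
    f0 → nonneg-cross {a} {c} t₀ t₂ ac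
    (fs f0) → nonneg-cross {b} {d} t₁ t₃ bd
    (fs (fs f0)) → nonneg-cross {c} {f} t₂ t₄ cf
    (fs (fs (fs f0))) → nonneg-cross {d} {a} t₃ t₀ da
    (fs (fs (fs (fs f0)))) → nonneg-cross {f} {b} t₄ t₁ fb

  pattern-least : ∀ {o} ps ss → Pattern o ss → Walk ps ss → ∀ j → vertex (ptTup ps) f0 ≤lex vertex (ptTup ps) j
  pattern-least _ ((_ , _) , (_ , _) , (_ , _) , (_ , _) , (_ , _)) pat (w₀ , w₁ , w₂ , w₃ , w₄)
    with up-a , up-b , down-d , down-f ← omits-lex pat = λ where
    f0 → inj₂ (refl , ℤP.≤-refl)
    (fs f0) → lexUp-step up-a w₀
    (fs (fs f0)) → ≤lex-trans (lexUp-step up-a w₀) (lexUp-step up-b w₁)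
    (fs (fs (fs f0))) → ≤lex-trans (lexDown-step down-f w₄) (lexDown-step down-d w₃)
    (fs (fs (fs (fs f0)))) → lexDown-step down-f w₄

  walk⇒pentagon : ∀ {o} ps ss → Pattern o ss → Walk ps ss → IsPentagon (ptTup ps)
  walk⇒pentagon ps ss pat walk =
    (λ i → subst NetDirection (sym (edges i)) (vec-netDirection (side ss i))) ,
    convex-from-turns (ptTup ps)
      (λ i → subst₂ (λ u w → + 0 < cross u w) (sym (edges i)) (sym (edges (next i))) (pattern-left ss pat i))
      (λ i → subst₂ (λ u w → + 0 ≤ cross u w) (sym (edges i)) (sym (edges (next (next i))))
               (pattern-nonright ss pat i)) ,
    pattern-least ps ss pat walk
    where
    edges = walk-edges ps ss walk

  consecutive-turn : ∀ p → (∀ i j → j ≢ i → j ≢ next i → + 0 < cross (edge p i) (vertex p j ⊖ vertex p i)) →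
                     ∀ i → + 0 < cross (edge p i) (edge p (next i))
  consecutive-turn p convex i =
    subst (+ 0 <_) (ahead (vertex p i) (vertex p (next i)) (vertex p (next (next i))))
          (convex i (next (next i)) (skip≢ i) (skip≢next i))
    where
    skip≢ : ∀ i → next (next i) ≢ i
    skip≢ f0 ()
    skip≢ (fs f0) ()
    skip≢ (fs (fs f0)) ()
    skip≢ (fs (fs (fs f0))) ()
    skip≢ (fs (fs (fs (fs f0)))) ()
    skip≢next : ∀ i → next (next i) ≢ next i
    skip≢next f0 ()
    skip≢next (fs f0) ()
    skip≢next (fs (fs f0)) ()
    skip≢next (fs (fs (fs f0))) ()
    skip≢next (fs (fs (fs (fs f0)))) ()

  turn-of : ∀ p → (∀ i j → j ≢ i → j ≢ next i → + 0 < cross (edge p i) (vertex p j ⊖ vertex p i)) →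
            ∀ i {s s′} → edge p i ≡ vec s → edge p (next i) ≡ vec s′ → proj₁ s ↺ proj₁ s′
  turn-of p convex i {_ , _} {_ , _} e e′ =
    left-turn (subst₂ (λ u w → + 0 < cross u w) e e′ (consecutive-turn p convex i))

  pentagon⇒walk : ∀ ps → IsPentagon (ptTup ps) → ∃[ o ] ∃[ ss ] Pattern o ss × Walk ps ss
  pentagon⇒walk ps@(p₀ , p₁ , p₂ , p₃ , p₄) (directions , convex , least) =
    trace (netDirection-vec _ (directions f0)) (netDirection-vec _ (directions (fs f0)))
          (netDirection-vec _ (directions (fs (fs f0)))) (netDirection-vec _ (directions (fs (fs (fs f0)))))
          (netDirection-vec _ (directions (fs (fs (fs (fs f0))))))
    where
    t = ptTup ps
    trace : ∃[ s ] edge t f0 ≡ vec s → ∃[ s ] edge t (fs f0) ≡ vec s → ∃[ s ] edge t (fs (fs f0)) ≡ vec s →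
            ∃[ s ] edge t (fs (fs (fs f0))) ≡ vec s → ∃[ s ] edge t (fs (fs (fs (fs f0)))) ≡ vec s →
            ∃[ o ] ∃[ ss ] Pattern o ss × Walk ps ss
    trace (s₀ , e₀) (s₁ , e₁) (s₂ , e₂) (s₃ , e₃) (s₄ , e₄) =
      proj₁ shape , (s₀ , s₁ , s₂ , s₃ , s₄) , proj₂ shape ,
      (vec⇒step s₀ p₀ p₁ e₀ , vec⇒step s₁ p₁ p₂ e₁ , vec⇒step s₂ p₂ p₃ e₂ , vec⇒step s₃ p₃ p₄ e₃ , vec⇒step s₄ p₄ p₀ e₄)
      where
      shape = turn-pattern (lexUp-of s₀ p₀ p₁ (vec⇒step s₀ p₀ p₁ e₀) (least (fs f0)))
                           (turn-of t convex f0 e₀ e₁) (turn-of t convex (fs f0) e₁ e₂)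
                           (turn-of t convex (fs (fs f0)) e₂ e₃) (turn-of t convex (fs (fs (fs f0))) e₃ e₄)
                           (turn-of t convex (fs (fs (fs (fs f0)))) e₄ e₀)
                           (lexDown-of s₄ p₄ p₀ (vec⇒step s₄ p₄ p₀ e₄) (least (fs (fs (fs (fs f0))))))

  omits-heights : ∀ {o a b c d f} → Omits o a b c d f → Rising a × Rising b × Rising c × Falling d
  omits-heights omit5 = rise0 , rise1 , rise2 , fall3
  omits-heights omit4 = rise5 , rise0 , rise1 , fall2
  omits-heights omit3 = rise5 , rise0 , rise1 , fall2
  omits-heights omit2 = rise5 , rise0 , rise1 , fall3
  omits-heights omit1 = rise5 , rise0 , rise2 , fall3
  omits-heights omit0 = rise5 , rise1 , rise2 , fall3

  Below : ℕ → NTup → Set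
  Below h (p₀ , p₁ , p₂ , p₃ , p₄) =
    height p₀ ℕ.≤ h × height p₁ ℕ.≤ h × height p₂ ℕ.≤ h × height p₃ ℕ.≤ h × height p₄ ℕ.≤ h

  below-mono : ∀ {h n} ps → Below h ps → h ℕ.≤ n → Below n ps
  below-mono _ (b₀ , b₁ , b₂ , b₃ , b₄) h≤n =
    ℕP.≤-trans b₀ h≤n , ℕP.≤-trans b₁ h≤n , ℕP.≤-trans b₂ h≤n , ℕP.≤-trans b₃ h≤n , ℕP.≤-trans b₄ h≤n

  -- In each pattern the fourth vertex p₃ is a highest one: the height rises
  -- along the first three sides and falls along the fourth.
  walk-below : ∀ {o} ps ss → Pattern o ss → Walk ps ss → Below (height (proj₁ (proj₂ (proj₂ (proj₂ ps))))) ps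
  walk-below _ ((_ , _) , (_ , _) , (_ , _) , (_ , _) , (_ , _)) pat (w₀ , w₁ , w₂ , w₃ , w₄)
    with rise-a , rise-b , rise-c , fall-d ← omits-heights pat =
    ℕP.≤-trans h₀≤h₁ (ℕP.≤-trans h₁≤h₂ h₂≤h₃) , ℕP.≤-trans h₁≤h₂ h₂≤h₃ , h₂≤h₃ , ℕP.≤-refl , falling-step fall-d w₃
    where
    h₀≤h₁ = rising-step rise-a w₀
    h₁≤h₂ = rising-step rise-b w₁
    h₂≤h₃ = rising-step rise-c w₂

module Parametrisation where

  open import Defs
  open Counting
  open NetTuples
  open Simplices
  open ClosedForms using (upCount; downCount; pentagonCount)
  open Directions
  open Pentagons
  open import Data.Nat as ℕ using (ℕ; zero; suc; _+_; _≤_; s≤s)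
  import Data.Nat.Properties as ℕP
  open import Data.Nat.Tactic.RingSolver using (solve-∀)
  open import Data.Integer as ℤ using (+_)
  open import Data.Fin using (Fin) renaming (zero to f0; suc to fs)
  open import Data.Product using (_×_; _,_; proj₁; proj₂; ∃-syntax; uncurry)
  open import Data.List as List using (List; []; _∷_; map; concatMap; length; filter)
  open import Data.List.Properties using (length-++; length-map)
  open import Data.List.Membership.Propositional using (_∈_; find)
  open import Data.List.Membership.Propositional.Properties using (∈-map⁺; ∈-map⁻; ∈-concatMap⁺; ∈-concatMap⁻; ∈-filter⁺; ∈-filter⁻)
  open import Data.List.Relation.Unary.Any using (here; there)
  import Data.List.Relation.Unary.Any as Any
  open import Data.List.Relation.Unary.All using ([]; _∷_)
  import Data.Nat.ListAction as ListAction
  open import Data.List.Relation.Unary.Unique.Propositional using (Unique)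
  open import Data.List.Relation.Unary.AllPairs using ([]; _∷_)
  import Data.List.Relation.Unary.Unique.Propositional.Properties as Unique
  open import Data.Vec using (Vec; []; _∷_; sum)
  open import Relation.Binary.PropositionalEquality
  open import Function using (_∘_)

  Par : Set
  Par = Dir × Vec ℕ 5

  -- For the omitted directions d5, d3, d1 the parameters are the least vertex's
  -- x, the second vertex's y and three side lengths minus one; for d4, d2, d0 the
  -- first one is a side length c that enters the size twice.
  corners : Par → NTup
  corners (d5 , a ∷ b ∷ t₁ ∷ t₂ ∷ t₃ ∷ []) =
    (a , b) , (a + suc t₃ + suc t₂ , b) , (a + suc t₃ + suc t₂ , b + suc t₁) ,
    (a + suc t₃ , b + suc t₁ + suc t₂) , (a , b + suc t₁ + suc t₂)
  corners (d3 , a ∷ b ∷ t₀ ∷ t₁ ∷ t₂ ∷ []) =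
    (a , b + suc t₀) , (a + suc t₀ , b) , (a + suc t₀ + suc t₁ , b) ,
    (a + suc t₀ + suc t₁ , b + suc t₂) , (a , b + suc t₂ + suc (t₀ + suc t₁))
  corners (d1 , a ∷ b ∷ t₀ ∷ t₃ ∷ t₄ ∷ []) =
    (a , b + suc t₀) , (a + suc t₀ , b) , (a + suc t₃ + suc (t₀ + suc t₄) , b) ,
    (a + suc t₃ , b + suc (t₀ + suc t₄)) , (a , b + suc (t₀ + suc t₄))
  corners (d4 , c ∷ a ∷ b ∷ u ∷ v ∷ []) =
    (a , b + suc c + suc v) , (a + suc (c + suc v) , b) , (a + suc (c + suc v) + suc u , b) ,
    (a + suc (c + suc v) + suc u , b + suc c) , (a + suc (u + suc c) , b + suc c + suc v)
  corners (d2 , c ∷ a ∷ b ∷ u ∷ v ∷ []) =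
    (a , b + suc c) , (a + suc c , b) , (a + suc c + suc u , b) ,
    (a + suc c + suc u , b + suc (c + suc v)) , (a , b + suc c + suc v)
  corners (d0 , c ∷ a ∷ b ∷ u ∷ v ∷ []) =
    (a , b + suc (c + suc u)) , (a + suc c + suc u , b) , (a + suc c + suc u , b + suc (c + suc v)) ,
    (a + suc c , b + suc (c + suc v) + suc u) , (a , b + suc (c + suc v) + suc u)

  sides : Par → Sides
  sides (d5 , a ∷ b ∷ t₁ ∷ t₂ ∷ t₃ ∷ []) = (d0 , t₃ + suc t₂) , (d1 , t₁) , (d2 , t₂) , (d3 , t₃) , (d4 , t₁ + suc t₂)
  sides (d3 , a ∷ b ∷ t₀ ∷ t₁ ∷ t₂ ∷ []) = (d5 , t₀) , (d0 , t₁) , (d1 , t₂) , (d2 , t₀ + suc t₁) , (d4 , t₁ + suc t₂)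
  sides (d1 , a ∷ b ∷ t₀ ∷ t₃ ∷ t₄ ∷ []) = (d5 , t₀) , (d0 , t₃ + suc t₄) , (d2 , t₀ + suc t₄) , (d3 , t₃) , (d4 , t₄)
  sides (d4 , c ∷ a ∷ b ∷ u ∷ v ∷ []) = (d5 , c + suc v) , (d0 , u) , (d1 , c) , (d2 , v) , (d3 , u + suc c)
  sides (d2 , c ∷ a ∷ b ∷ u ∷ v ∷ []) = (d5 , c) , (d0 , u) , (d1 , c + suc v) , (d3 , c + suc u) , (d4 , v)
  sides (d0 , c ∷ a ∷ b ∷ u ∷ v ∷ []) = (d5 , c + suc u) , (d1 , c + suc v) , (d2 , u) , (d3 , c) , (d4 , v)

  sides-pattern : ∀ r → Pattern (proj₁ r) (sides r)
  sides-pattern (d5 , _ ∷ _ ∷ _ ∷ _ ∷ _ ∷ []) = omit5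
  sides-pattern (d3 , _ ∷ _ ∷ _ ∷ _ ∷ _ ∷ []) = omit3
  sides-pattern (d1 , _ ∷ _ ∷ _ ∷ _ ∷ _ ∷ []) = omit1
  sides-pattern (d4 , _ ∷ _ ∷ _ ∷ _ ∷ _ ∷ []) = omit4
  sides-pattern (d2 , _ ∷ _ ∷ _ ∷ _ ∷ _ ∷ []) = omit2
  sides-pattern (d0 , _ ∷ _ ∷ _ ∷ _ ∷ _ ∷ []) = omit0

  corners-walk : ∀ r → Walk (corners r) (sides r)
  corners-walk (d5 , a ∷ b ∷ t₁ ∷ t₂ ∷ t₃ ∷ []) =
    (ℕP.+-assoc a (suc t₃) (suc t₂) , refl) , (refl , refl) , (refl , refl) , (refl , refl) ,
    (refl , ℕP.+-assoc b (suc t₁) (suc t₂))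
  corners-walk (d3 , a ∷ b ∷ t₀ ∷ t₁ ∷ t₂ ∷ []) =
    (refl , refl) , (refl , refl) , (refl , refl) , (ℕP.+-assoc a (suc t₀) (suc t₁) , refl) ,
    (refl , closing b t₀ t₁ t₂)
    where
    closing : ∀ b t₀ t₁ t₂ → b + suc t₂ + suc (t₀ + suc t₁) ≡ b + suc t₀ + suc (t₁ + suc t₂)
    closing = solve-∀
  corners-walk (d1 , a ∷ b ∷ t₀ ∷ t₃ ∷ t₄ ∷ []) =
    (refl , refl) , (closing a t₀ t₃ t₄ , refl) , (refl , refl) , (refl , refl) ,
    (refl , sym (ℕP.+-assoc b (suc t₀) (suc t₄)))
    where
    closing : ∀ a t₀ t₃ t₄ → a + suc t₃ + suc (t₀ + suc t₄) ≡ a + suc t₀ + suc (t₃ + suc t₄)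
    closing = solve-∀
  corners-walk (d4 , c ∷ a ∷ b ∷ u ∷ v ∷ []) =
    (refl , ℕP.+-assoc b (suc c) (suc v)) , (refl , refl) , (refl , refl) , (closing a c u v , refl) ,
    (refl , refl)
    where
    closing : ∀ a c u v → a + suc (c + suc v) + suc u ≡ a + suc (u + suc c) + suc v
    closing = solve-∀
  corners-walk (d2 , c ∷ a ∷ b ∷ u ∷ v ∷ []) =
    (refl , refl) , (refl , refl) , (refl , refl) ,
    (ℕP.+-assoc a (suc c) (suc u) , ℕP.+-assoc b (suc c) (suc v)) , (refl , refl)
  corners-walk (d0 , c ∷ a ∷ b ∷ u ∷ v ∷ []) =
    (ℕP.+-assoc a (suc c) (suc u) , refl) , (refl , refl) , (refl , refl) , (refl , refl) ,
    (refl , closing b c u v)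
    where
    closing : ∀ b c u v → b + suc (c + suc v) + suc u ≡ b + suc (c + suc u) + suc v
    closing = solve-∀

  -- The size of a pentagon, i.e. the height of its highest vertex p₃.
  size : Par → ℕ
  size (d5 , v) = 3 + sum v
  size (d3 , v) = 3 + sum v
  size (d1 , v) = 3 + sum v
  size (d4 , c ∷ w) = 4 + (c + c + sum w)
  size (d2 , c ∷ w) = 4 + (c + c + sum w)
  size (d0 , c ∷ w) = 4 + (c + c + sum w)

  apex : NTup → NPoint
  apex (_ , _ , _ , p₃ , _) = p₃

  apex-below : ∀ {n} ps → Below n ps → height (apex ps) ≤ n
  apex-below _ (_ , _ , _ , b₃ , _) = b₃

  apex-height : ∀ r → height (apex (corners r)) ≡ size r
  apex-height (d5 , a ∷ b ∷ t₁ ∷ t₂ ∷ t₃ ∷ []) = identity a b t₁ t₂ t₃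
    where
    identity : ∀ a b t₁ t₂ t₃ → a + suc t₃ + (b + suc t₁ + suc t₂) ≡ 3 + (a + (b + (t₁ + (t₂ + (t₃ + 0)))))
    identity = solve-∀
  apex-height (d3 , a ∷ b ∷ t₀ ∷ t₁ ∷ t₂ ∷ []) = identity a b t₀ t₁ t₂
    where
    identity : ∀ a b t₀ t₁ t₂ → a + suc t₀ + suc t₁ + (b + suc t₂) ≡ 3 + (a + (b + (t₀ + (t₁ + (t₂ + 0)))))
    identity = solve-∀
  apex-height (d1 , a ∷ b ∷ t₀ ∷ t₃ ∷ t₄ ∷ []) = identity a b t₀ t₃ t₄
    where
    identity : ∀ a b t₀ t₃ t₄ → a + suc t₃ + (b + suc (t₀ + suc t₄)) ≡ 3 + (a + (b + (t₀ + (t₃ + (t₄ + 0)))))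
    identity = solve-∀
  apex-height (d4 , c ∷ a ∷ b ∷ u ∷ v ∷ []) = identity c a b u v
    where
    identity : ∀ c a b u v → a + suc (c + suc v) + suc u + (b + suc c) ≡ 4 + (c + c + (a + (b + (u + (v + 0)))))
    identity = solve-∀
  apex-height (d2 , c ∷ a ∷ b ∷ u ∷ v ∷ []) = identity c a b u v
    where
    identity : ∀ c a b u v → a + suc c + suc u + (b + suc (c + suc v)) ≡ 4 + (c + c + (a + (b + (u + (v + 0)))))
    identity = solve-∀
  apex-height (d0 , c ∷ a ∷ b ∷ u ∷ v ∷ []) = identity c a b u v
    where
    identity : ∀ c a b u v → a + suc c + (b + suc (c + suc v) + suc u) ≡ 4 + (c + c + (a + (b + (u + (v + 0)))))
    identity = solve-∀

  corners-pentagon : ∀ r → IsPentagon (ptTup (corners r))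
  corners-pentagon r = walk⇒pentagon (corners r) (sides r) (sides-pattern r) (corners-walk r)

  below-in-net : ∀ {n} ps → Below n ps → ptTup ps ∈ tuples (netVertices n)
  below-in-net (p₀ , p₁ , p₂ , p₃ , p₄) (b₀ , b₁ , b₂ , b₃ , b₄) =
    ∈-tuples⁺ (∈-netVertices⁺ p₀ b₀) (∈-netVertices⁺ p₁ b₁) (∈-netVertices⁺ p₂ b₂)
              (∈-netVertices⁺ p₃ b₃) (∈-netVertices⁺ p₄ b₄)

  corners-in-net : ∀ {n} r → size r ≤ n → ptTup (corners r) ∈ tuples (netVertices n)
  corners-in-net r size≤n = below-in-net (corners r) (below-mono (corners r) below size≤n)
    where
    below = subst (λ h → Below h (corners r)) (apex-height r)
                  (walk-below (corners r) (sides r) (sides-pattern r) (corners-walk r))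

  -- The closing conditions of the walks: each determines one side length from
  -- the others (z + 1 + x = z + 1 + y gives x = y after regrouping).
  private
    closing : ∀ z x y {l r} → l ≡ z + suc x → r ≡ z + suc y → l ≡ r → y ≡ x
    closing z x y l≡ r≡ l≡r =
      sym (ℕP.suc-injective (ℕP.+-cancelˡ-≡ z (suc x) (suc y) (trans (sym l≡) (trans l≡r r≡))))

    closing-assoc : ∀ {z p q r} → z + suc p + suc q ≡ z + suc r → r ≡ p + suc q
    closing-assoc {z} {p} {q} {r} = closing z (p + suc q) r (ℕP.+-assoc z (suc p) (suc q)) refl

    closing-nested : ∀ {a p q r s} → a + suc (p + suc q) + suc r ≡ a + suc s + suc q → s ≡ r + suc p
    closing-nested {a} {p} {q} {r} {s} = closing (a + suc q) (r + suc p) s (lhs a p q r) (rhs a q s)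
      where
      lhs : ∀ a p q r → a + suc (p + suc q) + suc r ≡ a + suc q + suc (r + suc p)
      lhs = solve-∀
      rhs : ∀ a q s → a + suc s + suc q ≡ a + suc q + suc s
      rhs = solve-∀

    closing-swap : ∀ {b p q r s} → b + suc p + suc (q + suc r) ≡ b + suc q + suc s → s ≡ r + suc p
    closing-swap {b} {p} {q} {r} {s} = closing (b + suc q) (r + suc p) s (lhs b p q r) refl
      where
      lhs : ∀ b p q r → b + suc p + suc (q + suc r) ≡ b + suc q + suc (r + suc p)
      lhs = solve-∀

    closing-swap′ : ∀ {a p q r s} → a + suc p + suc (q + suc r) ≡ a + suc q + suc s → s ≡ p + suc r
    closing-swap′ {a} {p} {q} {r} {s} = closing (a + suc q) (p + suc r) s (lhs a p q r) refl
      where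
      lhs : ∀ a p q r → a + suc p + suc (q + suc r) ≡ a + suc q + suc (p + suc r)
      lhs = solve-∀

    closing-shift : ∀ {b p q r s} → b + suc s + suc q ≡ b + suc (p + suc q) + suc r → s ≡ p + suc r
    closing-shift {b} {p} {q} {r} {s} = closing (b + suc q) (p + suc r) s (lhs b p q r) (rhs b q s) ∘ sym
      where
      lhs : ∀ b p q r → b + suc (p + suc q) + suc r ≡ b + suc q + suc (p + suc r)
      lhs = solve-∀
      rhs : ∀ b q s → b + suc s + suc q ≡ b + suc q + suc s
      rhs = solve-∀

  walk⇒corners : ∀ {o} ps ss → Pattern o ss → Walk ps ss → ∃[ v ] ps ≡ corners (o , v)
  walk⇒corners ((x₀ , y₀) , _) ((d0 , _) , (d1 , t₁) , (d2 , t₂) , (d3 , t₃) , (d4 , _)) omit5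
    ((_ , refl) , (refl , refl) , (refl , refl) , (refl , refl) , (refl , _)) =
    (x₀ ∷ y₀ ∷ t₁ ∷ t₂ ∷ t₃ ∷ []) , refl
  walk⇒corners ((x₀ , _) , (_ , y₁) , _) ((d5 , _) , (d0 , t₁) , (d1 , t₂) , (d2 , t₃) , (d3 , _)) omit4
    ((refl , y-closes) , (refl , refl) , (refl , refl) , (x-closes , refl) , (refl , refl))
    with closing-assoc y-closes
  ... | refl with closing-nested x-closes
  ... | refl = (t₂ ∷ x₀ ∷ y₁ ∷ t₁ ∷ t₃ ∷ []) , refl
  walk⇒corners ((x₀ , _) , (_ , y₁) , _) ((d5 , t₀) , (d0 , t₁) , (d1 , t₂) , (d2 , _) , (d4 , _)) omit3
    ((refl , refl) , (refl , refl) , (refl , refl) , (x-closes , refl) , (refl , y-closes))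
    with closing-assoc x-closes
  ... | refl with closing-swap y-closes
  ... | refl = (x₀ ∷ y₁ ∷ t₀ ∷ t₁ ∷ t₂ ∷ []) , refl
  walk⇒corners ((x₀ , _) , (_ , y₁) , _) ((d5 , t₀) , (d0 , t₁) , (d1 , _) , (d3 , _) , (d4 , t₄)) omit2
    ((refl , refl) , (refl , refl) , (refl , refl) , (x-closes , y-closes) , (refl , refl))
    with closing-assoc x-closes
  ... | refl with closing-assoc y-closes
  ... | refl = (t₀ ∷ x₀ ∷ y₁ ∷ t₁ ∷ t₄ ∷ []) , refl
  walk⇒corners ((x₀ , _) , (_ , y₁) , _) ((d5 , t₀) , (d0 , _) , (d2 , _) , (d3 , t₃) , (d4 , t₄)) omit1
    ((refl , refl) , (x-closes , refl) , (refl , refl) , (refl , refl) , (refl , y-closes))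
    with closing-assoc (sym y-closes)
  ... | refl with closing-swap′ x-closes
  ... | refl = (x₀ ∷ y₁ ∷ t₀ ∷ t₃ ∷ t₄ ∷ []) , refl
  walk⇒corners ((x₀ , _) , (_ , y₁) , _) ((d5 , _) , (d1 , _) , (d2 , t₂) , (d3 , t₃) , (d4 , t₄)) omit0
    ((x-closes , refl) , (refl , refl) , (refl , refl) , (refl , refl) , (refl , y-closes))
    with closing-assoc x-closes
  ... | refl with closing-shift y-closes
  ... | refl = (t₃ ∷ x₀ ∷ y₁ ∷ t₂ ∷ t₄ ∷ []) , refl

  -- Decoding: the parameters can be read back from the corner tuple, so the
  -- parametrisation is injective.
  dirOf : Point → Dir
  dirOf (+ suc _ , + zero) = d0
  dirOf (+ zero , + suc _) = d1
  dirOf (ℤ.-[1+ _ ] , + suc _) = d2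
  dirOf (ℤ.-[1+ _ ] , + zero) = d3
  dirOf (+ zero , ℤ.-[1+ _ ]) = d4
  dirOf _ = d5

  lengthOf : Point → ℕ
  lengthOf (+ zero , y) = ℕ.pred ℤ.∣ y ∣
  lengthOf (x , _) = ℕ.pred ℤ.∣ x ∣

  omitted : Dir → Dir → Dir → Dir → Dir → Dir
  omitted d0 _ _ _ _ = d5
  omitted _ d1 _ _ _ = d0
  omitted _ _ d2 _ _ = d1
  omitted _ _ _ d3 _ = d2
  omitted _ _ _ _ d4 = d3
  omitted _ _ _ _ _ = d4

  read : ℕ → ℕ → Point × Point × Point × Point × Point → Par
  read a b (e₀ , e₁ , e₂ , e₃ , e₄) = o , lengths o
    where
    o = omitted (dirOf e₀) (dirOf e₁) (dirOf e₂) (dirOf e₃) (dirOf e₄)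
    lengths : Dir → Vec ℕ 5
    lengths d5 = a ∷ b ∷ lengthOf e₁ ∷ lengthOf e₂ ∷ lengthOf e₃ ∷ []
    lengths d3 = a ∷ b ∷ lengthOf e₀ ∷ lengthOf e₁ ∷ lengthOf e₂ ∷ []
    lengths d1 = a ∷ b ∷ lengthOf e₀ ∷ lengthOf e₃ ∷ lengthOf e₄ ∷ []
    lengths d4 = lengthOf e₂ ∷ a ∷ b ∷ lengthOf e₁ ∷ lengthOf e₃ ∷ []
    lengths d2 = lengthOf e₀ ∷ a ∷ b ∷ lengthOf e₁ ∷ lengthOf e₄ ∷ []
    lengths d0 = lengthOf e₃ ∷ a ∷ b ∷ lengthOf e₂ ∷ lengthOf e₄ ∷ []

  decode : Tup → Par
  decode t@((x₀ , _) , (_ , y₁) , _) =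
    read ℤ.∣ x₀ ∣ ℤ.∣ y₁ ∣ (edge t f0 , edge t (fs f0) , edge t (fs (fs f0)) , edge t (fs (fs (fs f0))) ,
                            edge t (fs (fs (fs (fs f0)))))

  read-sides : ∀ r → let (s₀ , s₁ , s₂ , s₃ , s₄) = sides r ; ((a , _) , (_ , b) , _) = corners r in
               read a b (vec s₀ , vec s₁ , vec s₂ , vec s₃ , vec s₄) ≡ r
  read-sides (d5 , _ ∷ _ ∷ _ ∷ _ ∷ _ ∷ []) = refl
  read-sides (d3 , _ ∷ _ ∷ _ ∷ _ ∷ _ ∷ []) = refl
  read-sides (d1 , _ ∷ _ ∷ _ ∷ _ ∷ _ ∷ []) = refl
  read-sides (d4 , _ ∷ _ ∷ _ ∷ _ ∷ _ ∷ []) = refl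
  read-sides (d2 , _ ∷ _ ∷ _ ∷ _ ∷ _ ∷ []) = refl
  read-sides (d0 , _ ∷ _ ∷ _ ∷ _ ∷ _ ∷ []) = refl

  decode-corners : ∀ r → decode (ptTup (corners r)) ≡ r
  decode-corners r = trans (cong (read _ _) edges) (read-sides r)
    where
    E = walk-edges (corners r) (sides r) (corners-walk r)
    edges = cong₂ _,_ (E f0) (cong₂ _,_ (E (fs f0)) (cong₂ _,_ (E (fs (fs f0)))
              (cong₂ _,_ (E (fs (fs (fs f0)))) (E (fs (fs (fs (fs f0))))))))

  corners-injective : ∀ {r r′} → ptTup (corners r) ≡ ptTup (corners r′) → r ≡ r′
  corners-injective {r} {r′} eq = trans (sym (decode-corners r)) (trans (cong decode eq) (decode-corners r′))

  upParams downParams : ℕ → List (Vec ℕ 5)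
  upParams (suc (suc (suc m))) = simplex 5 m
  upParams _ = []
  downParams (suc (suc (suc (suc m)))) = skewSimplex 4 m
  downParams _ = []

  params : Dir → ℕ → List (Vec ℕ 5)
  params d5 = upParams
  params d3 = upParams
  params d1 = upParams
  params d4 = downParams
  params d2 = downParams
  params d0 = downParams

  ∈-params⁺ : ∀ {n} r → size r ≤ n → proj₂ r ∈ params (proj₁ r) n
  ∈-params⁺ {n} (o , v) = helper o n v
    where
    up : ∀ n v → 3 + sum v ≤ n → v ∈ upParams n
    up (suc (suc (suc m))) v (s≤s (s≤s (s≤s le))) = ∈-simplex⁺ 5 m v le
    down : ∀ n c w → 4 + (c + c + sum w) ≤ n → (c ∷ w) ∈ downParams n
    down (suc (suc (suc (suc m)))) c w (s≤s (s≤s (s≤s (s≤s le)))) = ∈-skewSimplex⁺ 4 m c w le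
    helper : ∀ o n v → size (o , v) ≤ n → v ∈ params o n
    helper d5 n v = up n v
    helper d3 n v = up n v
    helper d1 n v = up n v
    helper d4 n (c ∷ w) = down n c w
    helper d2 n (c ∷ w) = down n c w
    helper d0 n (c ∷ w) = down n c w

  ∈-params⁻ : ∀ {n} r → proj₂ r ∈ params (proj₁ r) n → size r ≤ n
  ∈-params⁻ {n} (o , v) = helper o n v
    where
    up : ∀ n v → v ∈ upParams n → 3 + sum v ≤ n
    up (suc (suc (suc m))) v v∈ = s≤s (s≤s (s≤s (∈-simplex⁻ 5 m v v∈)))
    down : ∀ n c w → (c ∷ w) ∈ downParams n → 4 + (c + c + sum w) ≤ n
    down (suc (suc (suc (suc m)))) c w v∈ = s≤s (s≤s (s≤s (s≤s (∈-skewSimplex⁻ 4 m c w v∈))))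
    helper : ∀ o n v → v ∈ params o n → size (o , v) ≤ n
    helper d5 n v = up n v
    helper d3 n v = up n v
    helper d1 n v = up n v
    helper d4 n (c ∷ w) = down n c w
    helper d2 n (c ∷ w) = down n c w
    helper d0 n (c ∷ w) = down n c w

  upParams-unique : ∀ n → Unique (upParams n)
  upParams-unique zero = []
  upParams-unique (suc zero) = []
  upParams-unique (suc (suc zero)) = []
  upParams-unique (suc (suc (suc m))) = simplex-unique 5 m

  downParams-unique : ∀ n → Unique (downParams n)
  downParams-unique zero = []
  downParams-unique (suc zero) = []
  downParams-unique (suc (suc zero)) = []
  downParams-unique (suc (suc (suc zero))) = []
  downParams-unique (suc (suc (suc (suc m)))) = skewSimplex-unique 4 m

  params-unique : ∀ o n → Unique (params o n)
  params-unique d5 = upParams-unique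
  params-unique d3 = upParams-unique
  params-unique d1 = upParams-unique
  params-unique d4 = downParams-unique
  params-unique d2 = downParams-unique
  params-unique d0 = downParams-unique

  upParams-length : ∀ n → length (upParams n) ≡ upCount n
  upParams-length zero = refl
  upParams-length (suc zero) = refl
  upParams-length (suc (suc zero)) = refl
  upParams-length (suc (suc (suc m))) = simplex-length 5 m

  downParams-length : ∀ n → length (downParams n) ≡ downCount n
  downParams-length zero = refl
  downParams-length (suc zero) = refl
  downParams-length (suc (suc zero)) = refl
  downParams-length (suc (suc (suc zero))) = refl
  downParams-length (suc (suc (suc (suc m)))) = skewSimplex-length 4 m

  allDirs : List Dir
  allDirs = d5 ∷ d3 ∷ d1 ∷ d4 ∷ d2 ∷ d0 ∷ []

  ∈-allDirs : ∀ o → o ∈ allDirs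
  ∈-allDirs d5 = here refl
  ∈-allDirs d3 = there (here refl)
  ∈-allDirs d1 = there (there (here refl))
  ∈-allDirs d4 = there (there (there (here refl)))
  ∈-allDirs d2 = there (there (there (there (here refl))))
  ∈-allDirs d0 = there (there (there (there (there (here refl)))))

  allDirs-unique : Unique allDirs
  allDirs-unique = ((λ ()) ∷ (λ ()) ∷ (λ ()) ∷ (λ ()) ∷ (λ ()) ∷ []) ∷ ((λ ()) ∷ (λ ()) ∷ (λ ()) ∷ (λ ()) ∷ []) ∷
                   ((λ ()) ∷ (λ ()) ∷ (λ ()) ∷ []) ∷ ((λ ()) ∷ (λ ()) ∷ []) ∷ ((λ ()) ∷ []) ∷ ([] ∷ [])

  pars : ℕ → List Par
  pars n = concatMap (λ o → map (o ,_) (params o n)) allDirs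

  ∈-pars⁺ : ∀ {n} r → size r ≤ n → r ∈ pars n
  ∈-pars⁺ {n} (o , v) size≤n =
    ∈-concatMap⁺ (λ o → map (o ,_) (params o n))
      (Any.map (λ { refl → ∈-map⁺ (o ,_) (∈-params⁺ (o , v) size≤n) }) (∈-allDirs o))

  ∈-pars⁻ : ∀ {n} r → r ∈ pars n → size r ≤ n
  ∈-pars⁻ {n} r r∈ with find (∈-concatMap⁻ (λ o → map (o ,_) (params o n)) {xs = allDirs} r∈)
  ... | o , _ , r∈fibre with ∈-map⁻ (o ,_) r∈fibre
  ... | v , v∈ , refl = ∈-params⁻ (o , v) v∈

  pars-unique : ∀ n → Unique (pars n)
  pars-unique n = unique-concatMap proj₁ (λ o → map (o ,_) (params o n)) allDirs-unique
    (λ o → Unique.map⁺ (λ { refl → refl }) (params-unique o n)) fibre-key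
    where
    fibre-key : ∀ o r → r ∈ map (o ,_) (params o n) → proj₁ r ≡ o
    fibre-key o r r∈ with ∈-map⁻ (o ,_) r∈
    ... | _ , _ , refl = refl

  pars-length : ∀ n → length (pars n) ≡ pentagonCount n
  pars-length n =
    trans (fibres allDirs) (trans (cong₂ (λ u d → u + (u + (u + (d + (d + (d + 0))))))
                                          (upParams-length n) (downParams-length n))
                                   (sixfold (upCount n) (downCount n)))
    where
    fibres : ∀ os → length (concatMap (λ o → map (o ,_) (params o n)) os) ≡ ListAction.sum (List.map (λ o → length (params o n)) os)
    fibres [] = refl
    fibres (o ∷ os) = trans (length-++ (map (o ,_) (params o n)))
                            (cong₂ _+_ (length-map (o ,_) (params o n)) (fibres os))
    sixfold : ∀ u d → u + (u + (u + (d + (d + (d + 0))))) ≡ 3 ℕ.* u + 3 ℕ.* d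
    sixfold = solve-∀

  net-tuple : ∀ {n} t → t ∈ tuples (netVertices n) → ∃[ ps ] t ≡ ptTup ps × Below n ps
  net-tuple {n} (q₀ , q₁ , q₂ , q₃ , q₄) t∈ with ∈-tuples⁻ t∈
  ... | q₀∈ , q₁∈ , q₂∈ , q₃∈ , q₄∈
    with ∈-netVertices⁻ {n} q₀∈ | ∈-netVertices⁻ {n} q₁∈ | ∈-netVertices⁻ {n} q₂∈ | ∈-netVertices⁻ {n} q₃∈
       | ∈-netVertices⁻ {n} q₄∈
  ... | p₀ , refl , b₀ | p₁ , refl , b₁ | p₂ , refl , b₂ | p₃ , refl , b₃ | p₄ , refl , b₄ =
    (p₀ , p₁ , p₂ , p₃ , p₄) , refl , (b₀ , b₁ , b₂ , b₃ , b₄)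

  pentagon-parameters : ∀ {n} ps → Below n ps → IsPentagon (ptTup ps) → ∃[ r ] r ∈ pars n × ps ≡ corners r
  pentagon-parameters {n} ps below pentagon = from-walk (pentagon⇒walk ps pentagon)
    where
    from-walk : (∃[ o ] ∃[ ss ] Pattern o ss × Walk ps ss) → ∃[ r ] r ∈ pars n × ps ≡ corners r
    from-walk (o , ss , pat , walk) = let (v , ps≡) = walk⇒corners ps ss pat walk in
      (o , v) , ∈-pars⁺ (o , v) (subst (_≤ n) (apex-height (o , v)) (subst (λ q → height (apex q) ≤ n) ps≡ (apex-below ps below))) , ps≡

  parameters-pentagon : ∀ {n} r → r ∈ pars n → ptTup (corners r) ∈ tuples (netVertices n) × IsPentagon (ptTup (corners r))
  parameters-pentagon {n} r r∈ = corners-in-net {n} r (∈-pars⁻ {n} r r∈) , corners-pentagon r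

  tuple-parameters : ∀ {n} t → t ∈ tuples (netVertices n) → IsPentagon t → ∃[ r ] r ∈ pars n × t ≡ ptTup (corners r)
  tuple-parameters {n} t t∈ pentagon = pick (net-tuple {n} t t∈)
    where
    pick : ∃[ ps ] t ≡ ptTup ps × Below n ps → ∃[ r ] r ∈ pars n × t ≡ ptTup (corners r)
    pick (ps , t≡ps , below) = conclude (pentagon-parameters ps below (subst IsPentagon t≡ps pentagon))
      where
      conclude : ∃[ r ] r ∈ pars n × ps ≡ corners r → ∃[ r ] r ∈ pars n × t ≡ ptTup (corners r)
      conclude (r , r∈ , ps≡) = r , r∈ , trans t≡ps (cong ptTup ps≡)

  pentagons⊆corners : ∀ n {t} → t ∈ filter isPentagon? (tuples (netVertices n)) → t ∈ map (ptTup ∘ corners) (pars n)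
  pentagons⊆corners n {t} t∈ =
    found (uncurry (tuple-parameters {n} t) (∈-filter⁻ isPentagon? {xs = tuples (netVertices n)} t∈))
    where
    found : ∃[ r ] r ∈ pars n × t ≡ ptTup (corners r) → t ∈ map (ptTup ∘ corners) (pars n)
    found (r , r∈ , t≡) = subst (_∈ map (ptTup ∘ corners) (pars n)) (sym t≡) (∈-map⁺ (ptTup ∘ corners) r∈)

  corners⊆pentagons : ∀ n {t} → t ∈ map (ptTup ∘ corners) (pars n) → t ∈ filter isPentagon? (tuples (netVertices n))
  corners⊆pentagons n t∈ = found (∈-map⁻ (ptTup ∘ corners) t∈)
    where
    found : ∀ {t} → ∃[ r ] r ∈ pars n × t ≡ ptTup (corners r) → t ∈ filter isPentagon? (tuples (netVertices n))
    found (r , r∈ , refl) = uncurry (∈-filter⁺ isPentagon?) (parameters-pentagon {n} r r∈)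

  P≡pentagonCount : ∀ n → P n ≡ pentagonCount n
  P≡pentagonCount n = begin
    P n
      ≡⟨ count-tuples5 (netVertices n) ⟩
    count isPentagon? (tuples (netVertices n))
      ≡⟨ unique-length unique-pentagons unique-corners (pentagons⊆corners n) (corners⊆pentagons n) ⟩
    length (map (ptTup ∘ corners) (pars n))
      ≡⟨ length-map (ptTup ∘ corners) (pars n) ⟩
    length (pars n)
      ≡⟨ pars-length n ⟩
    pentagonCount n ∎
    where
    open ≡-Reasoning
    unique-pentagons : Unique (filter isPentagon? (tuples (netVertices n)))
    unique-pentagons = Unique.filter⁺ isPentagon? (tuples-unique (netVertices-unique n))
    unique-corners : Unique (map (ptTup ∘ corners) (pars n))
    unique-corners = Unique.map⁺ corners-injective (pars-unique n)

open import Defs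
open import Data.Nat using (ℕ; suc; _≥_)
open import Data.Integer using (ℤ; +_; _+_; _-_; _*_; _^_)
open import Data.Product using (_×_; _,_)
open import Relation.Binary.PropositionalEquality using (_≡_; trans; cong)
open ClosedForms using (pentagonCount-odd; pentagonCount-even)
open Parametrisation using (P≡pentagonCount)

theorem2p1 : ((k : ℕ) →
    + 10 * + P (suc (2 Data.Nat.* k))
      ≡ + 12 * (+ k) ^ 5 + + 25 * (+ k) ^ 4 + + 5 * (+ k) ^ 3 - + 10 * (+ k) ^ 2 - + 2 * + k)
  ×
  ((k : ℕ) → k ≥ 1 →
    + 10 * + P (2 Data.Nat.* k)
      ≡ + 12 * (+ k) ^ 5 - + 5 * (+ k) ^ 4 - + 15 * (+ k) ^ 3 + + 5 * (+ k) ^ 2 + + 3 * + k)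
theorem2p1 =
  (λ k → trans (cong (λ x → + 10 * + x) (P≡pentagonCount (suc (2 Data.Nat.* k)))) (pentagonCount-odd k)) ,
  (λ k k≥1 → trans (cong (λ x → + 10 * + x) (P≡pentagonCount (2 Data.Nat.* k))) (pentagonCount-even k k≥1))
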